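{- Let $n\ge2$ be even and $0\le j\le n$. Then \[ |\mathrm{Orb}_{even}(C_n,\mathrm{Neck}(n,j))_1^f| = \frac12 \left(\binom{\frac n2}{\frac j2}-\left|\mathrm{Orb}_{odd}\left(C_{\frac n2},\mathrm{Neck}\left(\tfrac n2,\tfrac j2\right)\right)^f\right|\right). \]
   Context: Place $n$ beads at the points $P_m=R^m(0,1)\in\mathbb R^2$, $m\in\mathbb Z/n$, $R$ the counterclockwise rotation by $2\pi/n$. $\mathrm{Neck}(n,j)$ is the set of colorings of these positions with $j$ blue and $n-j$ red beads. $C_n$ acts by rotation and the flip $f$ by reflection in the vertical axis ($P_m\mapsto P_{ -m}$); $f$ acts on the set $\mathrm{Orb}(C_n,\mathrm{Neck}(n,j))$ of rotation orbits, and a superscript $f$ denotes the subset of $f$-fixed orbits. Subscripts $even$/$odd$ denote orbits of even/odd cardinality. A line $\sigma$ through the origin is a symmetry axis of a necklace $l$ if reflection in $\sigma$ preserves the set of blue positions of $l$; it is of type 1 if it contains none of the points $P_m$. $\mathrm{Orb}_{even}(C_n,\mathrm{Neck}(n,j))^f_1$ is the set of $f$-fixed orbits of even cardinality having a representative with a type 1 symmetry axis. Conventions: if $j/2$ is not an integer then $\binom{n/2}{j/2}=0$ and $\mathrm{Neck}(n/2,j/2)=\emptyset$. -}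

module Defs where

open import Data.Bool using (Bool; true; false; if_then_else_)
open import Data.Nat using (ℕ; zero; suc; _+_; _*_; _∸_; _≤_; _<_)
open import Data.Nat.DivMod using (_mod_; _/_)
open import Data.Nat.Divisibility using (_∣_; _∣?_)
open import Data.Nat.Combinatorics using (_C_)
open import Data.Fin using (Fin; toℕ)
open import Data.Vec using (Vec; []; _∷_; lookup; tabulate)
open import Data.Vec.Properties using (≡-dec)
open import Data.List using (List; []; _∷_; map; _++_; length; filter; deduplicate; upTo)
open import Data.List.Relation.Unary.Any using (Any; any?)
open import Data.Product using (Σ; _×_; ∃-syntax)
open import Relation.Nullary using (Dec; ¬_; does)
open import Relation.Nullary.Decidable using (_×-dec_; ¬?)
open import Relation.Binary.PropositionalEquality using (_≡_)
import Data.Bool.Properties as BoolP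
import Data.Nat.Properties as NatP

-- A coloring of the n positions P_0,…,P_{n-1} (indices = Z/n):
-- entry m is true iff the bead at P_m is blue.
Coloring : ℕ → Set
Coloring n = Vec Bool n

_≟c_ : ∀ {n} (c d : Coloring n) → Dec (c ≡ d)
_≟c_ = ≡-dec BoolP._≟_

blues : ∀ {n} → Coloring n → ℕ
blues [] = 0
blues (true ∷ c) = suc (blues c)
blues (false ∷ c) = blues c

allColorings : (n : ℕ) → List (Coloring n)
allColorings zero = [] ∷ []
allColorings (suc n) = map (true ∷_) (allColorings n) ++ map (false ∷_) (allColorings n)

Neck : (n j : ℕ) → List (Coloring n)
Neck n j = filter (λ c → blues c NatP.≟ j) (allColorings n)

-- a mod n, as an element of Fin n (n is nonzero since Fin n is inhabited)
modF : ∀ {n} → Fin n → ℕ → Fin n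
modF {suc n} _ a = a mod (suc n)

-- rotation R : P_m ↦ P_{m+1} acting on colorings: (R c)(m) = c(m - 1)
rot : ∀ {n} → Coloring n → Coloring n
rot {n} c = tabulate (λ m → lookup c (modF m (toℕ m + (n ∸ 1))))

rot^ : ∀ {n} → ℕ → Coloring n → Coloring n
rot^ zero c = c
rot^ (suc k) c = rot (rot^ k c)

-- reflection σ_k : P_m ↦ P_{k-m} (all reflections in lines through the
-- origin that map the set {P_m} to itself); acting on colorings:
-- (σ_k c)(m) = c(k - m).  The flip f is σ_0.
refl-k : ∀ {n} → ℕ → Coloring n → Coloring n
refl-k {n} k c = tabulate (λ m → lookup c (modF m (k + n ∸ toℕ m)))

flip : ∀ {n} → Coloring n → Coloring n
flip = refl-k 0

orbitList : ∀ {n} → Coloring n → List (Coloring n)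
orbitList {n} c = map (λ k → rot^ k c) (upTo n)

InOrbit : ∀ {n} → Coloring n → Coloring n → Set
InOrbit c d = Any (d ≡_) (orbitList c)

inOrbit? : ∀ {n} (c d : Coloring n) → Dec (InOrbit c d)
inOrbit? c d = any? (d ≟c_) (orbitList c)

orbitSize : ∀ {n} → Coloring n → ℕ
orbitSize c = length (deduplicate _≟c_ (orbitList c))

-- Orb(C_n, Neck(n,j)): one representative per rotation orbit
Orb : (n j : ℕ) → List (Coloring n)
Orb n j = deduplicate inOrbit? (Neck n j)

-- the orbit of c is f-fixed: f maps the orbit of c to itself
-- (equivalently, f c lies in the orbit of c)
FFixed : ∀ {n} → Coloring n → Set
FFixed c = InOrbit c (flip c)

EvenOrbit : ∀ {n} → Coloring n → Set
EvenOrbit c = 2 ∣ orbitSize c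

-- c has a symmetry axis of type 1: for n even, the axis of σ_k contains
-- some P_m iff k ≡ 2m (mod n), i.e. iff k is even; so type-1 axes are
-- the σ_k with k odd (k < n).
HasType1Axis : ∀ {n} → Coloring n → Set
HasType1Axis {n} c = Any (λ k → ¬ (2 ∣ k) × refl-k k c ≡ c) (upTo n)

hasType1Axis? : ∀ {n} (c : Coloring n) → Dec (HasType1Axis c)
hasType1Axis? {n} c = any? (λ k → ¬? (2 ∣? k) ×-dec (refl-k k c ≟c c)) (upTo n)

OrbitType1 : ∀ {n} → Coloring n → Set
OrbitType1 {n} c = Any HasType1Axis (orbitList c)

orbitType1? : ∀ {n} (c : Coloring n) → Dec (OrbitType1 c)
orbitType1? c = any? hasType1Axis? (orbitList c)

fFixed? : ∀ {n} (c : Coloring n) → Dec (FFixed c)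
fFixed? c = inOrbit? c (flip c)

evenOrbit? : ∀ {n} (c : Coloring n) → Dec (EvenOrbit c)
evenOrbit? c = 2 ∣? orbitSize c

countEvenFixedType1 : (n j : ℕ) → ℕ
countEvenFixedType1 n j =
  length (filter (λ c → evenOrbit? c ×-dec fFixed? c ×-dec orbitType1? c) (Orb n j))

countOddFixed : (n j : ℕ) → ℕ
countOddFixed n j =
  length (filter (λ c → ¬? (evenOrbit? c) ×-dec fFixed? c) (Orb n j))

halfBinom : (n j : ℕ) → ℕ
halfBinom n j = if does (2 ∣? j) then (n / 2) C (j / 2) else 0

-- |Orb_odd(C_{n/2}, Neck(n/2, j/2))^f|, with Neck(n/2,j/2) = ∅ when j is odd
halfOddFixed : (n j : ℕ) → ℕ
halfOddFixed n j = if does (2 ∣? j) then countOddFixed (n / 2) (j / 2) else 0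

-- Let n = 2h and let τ be the reflection P_m ↦ P_{n−1−m}. Its axis is of type 1, and the colorings it
-- fixes are the palindromes y ++ reverse y, so Neck(n, j) contains binom(h, j/2) of them (none for odd j).
-- Count them orbit by orbit. If x and R^v x are both τ-fixed, then x is R^{2v}-periodic, so an orbit of
-- period p holds at most one τ-fixed coloring when p is odd and at most two, p/2 apart, when p is even.
-- Some rotation of x is τ-fixed iff some symmetry axis of x can be rotated onto that of τ: for an f-fixed
-- orbit of odd period this is always possible, as 2 is invertible mod p; otherwise it takes a type-1 axis
-- (and an orbit with any symmetry axis is f-fixed). So f-fixed odd orbits contribute 1, f-fixed even
-- orbits with a type-1 axis contribute 2, and all others 0. Finally an odd period divides h, so those
-- colorings are y ++ y, and doubling matches the τ-fixed ones of odd orbit size in Neck(n, j) with those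
-- in Neck(h, j/2), which the same count identifies with Orb_odd(C_h, Neck(h, j/2))^f.

module Submission where

open import Level using (Level)
open import Data.Bool using (Bool; true; false)
open import Data.Empty using (⊥-elim)
open import Data.Fin using (Fin; toℕ) renaming (zero to fzero; suc to fsuc)
open import Data.Fin.Properties using (toℕ-fromℕ<)
open import Data.List using (List; []; _∷_; map; length; filter; deduplicate; applyUpTo; upTo) renaming (_++_ to _++ᴸ_)
open import Data.List.Properties using (length-upTo)
open import Data.List.Relation.Unary.All using (All; []; _∷_)
import Data.List.Relation.Unary.All as All using (tabulate; lookup)
import Data.List.Relation.Unary.All.Properties as All
open import Data.List.Relation.Unary.Any using (Any; here; there)
import Data.List.Relation.Unary.Any as Any using (map)
import Data.List.Relation.Unary.Any.Properties as Any
import Data.List as L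
open import Data.Nat
  using (ℕ; zero; suc; _+_; _*_; _∸_; _/_; _%_; _<_; _≤_; _≟_; _<?_; _≤?_; s≤s; z≤n; s≤s⁻¹; ⌊_/2⌋; NonZero; >-nonZero)
open import Data.Nat.Properties
open import Data.Nat.Combinatorics using (_C_; nCk+nC[k+1]≡[n+1]C[k+1])
open import Data.Nat.Coprimality using (Coprime; coprime-divisor)
open import Data.Nat.DivMod using (_mod_; m≡m%n+[m/n]*n; [m+kn]%n≡m%n; m%n<n; m%n≤n; m<n⇒m%n≡m; m*n/n≡m)
open import Data.Nat.Divisibility using (_∣_; divides; _∣?_; m%n≡0⇒n∣m; ∣⇒≤)
open import Data.Nat.Primality using (irreducible[2])
open import Data.Nat.Tactic.RingSolver using (solve; solve-∀)
open import Data.Product using (Σ; _×_; _,_; proj₁; proj₂)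
open import Data.Sum using (_⊎_; inj₁; inj₂; [_,_]′)
import Data.Sum as Sum
open import Data.Vec using (Vec; []; _∷_; lookup; _++_; _∷ʳ_; reverse; initLast; splitAt)
open import Data.Vec.Properties using (lookup∘tabulate; reverse-∷; ∷-injective; ∷-injectiveʳ; ++-injectiveˡ)
open import Function using (id; _∘_)
open import Relation.Binary.Bundles using (Setoid)
open import Relation.Binary.Core using (Rel)
import Relation.Binary.Definitions as Binary
open import Relation.Binary.Definitions using (DecidableEquality)
open import Relation.Binary.PropositionalEquality
import Relation.Binary.Reasoning.Setoid as SetoidReasoning
open import Relation.Binary.Structures using (IsEquivalence)
open import Relation.Nullary using (¬_; Dec; yes; no; contradiction)
open import Relation.Nullary.Decidable using (_×-dec_; ¬?; dec-true; dec-false)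

open import Defs

private variable
  a b ℓ ℓ′ ℓ″ : Level
  A : Set a
  B : Set b
  P : Set ℓ
  Q : Set ℓ′
  m n : ℕ

∑ : List A → (A → ℕ) → ℕ
∑ []       f = 0
∑ (x ∷ xs) f = f x + ∑ xs f

syntax ∑ xs (λ x → e) = ∑[ x ∈ xs ] e

𝟙 : Dec P → ℕ
𝟙 (yes _) = 1
𝟙 (no _)  = 0

𝟙-yes : P → (d : Dec P) → 𝟙 d ≡ 1
𝟙-yes p (yes _) = refl
𝟙-yes p (no ¬p) = ⊥-elim (¬p p)

𝟙-no : ¬ P → (d : Dec P) → 𝟙 d ≡ 0
𝟙-no ¬p (yes p) = ⊥-elim (¬p p)
𝟙-no ¬p (no _)  = refl

𝟙-⇔ : (P → Q) → (Q → P) → (d : Dec P) (e : Dec Q) → 𝟙 d ≡ 𝟙 e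
𝟙-⇔ f g (yes p) e = sym (𝟙-yes (f p) e)
𝟙-⇔ f g (no ¬p) e = sym (𝟙-no (¬p ∘ g) e)

𝟙-×-dec : (d : Dec P) (e : Dec Q) → 𝟙 (d ×-dec e) ≡ 𝟙 d * 𝟙 e
𝟙-×-dec (yes _) (yes _) = refl
𝟙-×-dec (yes _) (no _)  = refl
𝟙-×-dec (no _)  _       = refl

𝟙-split : (d : Dec P) (e : Dec Q) → 𝟙 d ≡ 𝟙 (d ×-dec e) + 𝟙 (d ×-dec ¬? e)
𝟙-split (yes _) (yes _) = refl
𝟙-split (yes _) (no _)  = refl
𝟙-split (no _)  _       = refl

∑-cong : ∀ (xs : List A) {f g : A → ℕ} → (∀ x → f x ≡ g x) → ∑ xs f ≡ ∑ xs g
∑-cong []       e = refl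
∑-cong (x ∷ xs) e = cong₂ _+_ (e x) (∑-cong xs e)

∑-congᴬ : ∀ {R : A → Set ℓ″} {xs} {f g : A → ℕ} →
          All R xs → (∀ {x} → R x → f x ≡ g x) → ∑ xs f ≡ ∑ xs g
∑-congᴬ []         e = refl
∑-congᴬ (rx ∷ rxs) e = cong₂ _+_ (e rx) (∑-congᴬ rxs e)

∑-zero : ∀ (xs : List A) {f : A → ℕ} → (∀ x → f x ≡ 0) → ∑ xs f ≡ 0
∑-zero []       e = refl
∑-zero (x ∷ xs) e = cong₂ _+_ (e x) (∑-zero xs e)

∑-zeroᴬ : ∀ {R : A → Set ℓ″} {xs} {f : A → ℕ} →
          All R xs → (∀ {x} → R x → f x ≡ 0) → ∑ xs f ≡ 0
∑-zeroᴬ []         e = refl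
∑-zeroᴬ (rx ∷ rxs) e = cong₂ _+_ (e rx) (∑-zeroᴬ rxs e)

∑-+ : ∀ (xs : List A) (f g : A → ℕ) → ∑[ x ∈ xs ] (f x + g x) ≡ ∑ xs f + ∑ xs g
∑-+ []       f g = refl
∑-+ (x ∷ xs) f g = begin
  f x + g x + ∑[ x ∈ xs ] (f x + g x) ≡⟨ cong (f x + g x +_) (∑-+ xs f g) ⟩
  f x + g x + (∑ xs f + ∑ xs g)       ≡⟨ +-exchange (f x) (g x) (∑ xs f) (∑ xs g) ⟩
  f x + ∑ xs f + (g x + ∑ xs g)       ∎
  where
  open ≡-Reasoning
  +-exchange : ∀ a b c d → a + b + (c + d) ≡ a + c + (b + d)
  +-exchange = solve-∀

∑-*ˡ : ∀ (xs : List A) k (f : A → ℕ) → ∑[ x ∈ xs ] (k * f x) ≡ k * ∑ xs f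
∑-*ˡ []       k f = sym (*-zeroʳ k)
∑-*ˡ (x ∷ xs) k f = trans (cong (k * f x +_) (∑-*ˡ xs k f)) (sym (*-distribˡ-+ k (f x) (∑ xs f)))

∑-++ : ∀ (xs ys : List A) (f : A → ℕ) → ∑ (xs ++ᴸ ys) f ≡ ∑ xs f + ∑ ys f
∑-++ []       ys f = refl
∑-++ (x ∷ xs) ys f = trans (cong (f x +_) (∑-++ xs ys f)) (sym (+-assoc (f x) _ _))

∑-map : ∀ (g : B → A) (xs : List B) (f : A → ℕ) → ∑ (map g xs) f ≡ ∑ xs (f ∘ g)
∑-map g []       f = refl
∑-map g (x ∷ xs) f = cong (f (g x) +_) (∑-map g xs f)

∑-comm : ∀ (xs : List A) (ys : List B) (f : A → B → ℕ) →
         ∑[ x ∈ xs ] ∑[ y ∈ ys ] f x y ≡ ∑[ y ∈ ys ] ∑[ x ∈ xs ] f x y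
∑-comm []       ys f = sym (∑-zero ys (λ _ → refl))
∑-comm (x ∷ xs) ys f =
  trans (cong (∑ ys (f x) +_) (∑-comm xs ys f)) (sym (∑-+ ys (f x) (λ y → ∑[ x ∈ xs ] f x y)))

module _ {P : A → Set ℓ} (P? : ∀ x → Dec (P x)) where

  ∑-filter : ∀ (xs : List A) (f : A → ℕ) → ∑ (filter P? xs) f ≡ ∑[ x ∈ xs ] (𝟙 (P? x) * f x)
  ∑-filter []       f = refl
  ∑-filter (x ∷ xs) f with P? x
  ... | yes _ = cong₂ _+_ (sym (+-identityʳ (f x))) (∑-filter xs f)
  ... | no _  = ∑-filter xs f

  length-filter : ∀ (xs : List A) → length (filter P? xs) ≡ ∑[ x ∈ xs ] 𝟙 (P? x)
  length-filter []       = refl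
  length-filter (x ∷ xs) with P? x
  ... | yes _ = cong suc (length-filter xs)
  ... | no _  = length-filter xs

  ∑𝟙≡suc⇒Any : ∀ (xs : List A) {k} → ∑[ x ∈ xs ] 𝟙 (P? x) ≡ suc k → Any P xs
  ∑𝟙≡suc⇒Any (x ∷ xs) e with P? x
  ... | yes px = here px
  ... | no _   = there (∑𝟙≡suc⇒Any xs e)

length≡∑1 : ∀ (xs : List A) → length xs ≡ ∑[ x ∈ xs ] 1
length≡∑1 []       = refl
length≡∑1 (x ∷ xs) = cong suc (length≡∑1 xs)

module Multiplicity (_≟_ : DecidableEquality A) where

  multiplicity : List A → A → ℕ
  multiplicity xs c = ∑[ x ∈ xs ] 𝟙 (x ≟ c)

  module _ {P : A → Set ℓ} (P? : ∀ x → Dec (P x)) (xs : List A) where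

    ∑𝟙-unique : ∀ c → (∀ x → P x → x ≡ c) → P c →
                multiplicity xs c ≡ 1 → ∑[ x ∈ xs ] 𝟙 (P? x) ≡ 1
    ∑𝟙-unique c only pc m = trans (∑-cong xs (λ x → 𝟙-⇔ (only x) (λ { refl → pc }) (P? x) (x ≟ c))) m

    ∑𝟙-pair : ∀ c d → c ≢ d → (∀ x → P x → x ≡ c ⊎ x ≡ d) → P c → P d →
              multiplicity xs c ≡ 1 → multiplicity xs d ≡ 1 → ∑[ x ∈ xs ] 𝟙 (P? x) ≡ 2
    ∑𝟙-pair c d c≢d only pc pd mc md =
      trans (∑-cong xs split) (trans (∑-+ xs (λ x → 𝟙 (x ≟ c)) (λ x → 𝟙 (x ≟ d))) (cong₂ _+_ mc md))
      where
      split : ∀ x → 𝟙 (P? x) ≡ 𝟙 (x ≟ c) + 𝟙 (x ≟ d)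
      split x with P? x | x ≟ c | x ≟ d
      ... | _      | yes refl | yes refl = ⊥-elim (c≢d refl)
      ... | yes _  | yes _    | no _     = refl
      ... | yes _  | no _     | yes _    = refl
      ... | yes px | no x≢c   | no x≢d   = ⊥-elim ([ x≢c , x≢d ]′ (only x px))
      ... | no ¬px | yes refl | _        = ⊥-elim (¬px pc)
      ... | no ¬px | no _     | yes refl = ⊥-elim (¬px pd)
      ... | no _   | no _     | no _     = refl

    ∑𝟙-none : (∀ x → ¬ P x) → ∑[ x ∈ xs ] 𝟙 (P? x) ≡ 0
    ∑𝟙-none none = ∑-zero xs (λ x → 𝟙-no (none x) (P? x))

  multiplicity-applyUpTo : ∀ (f : ℕ → A) → (∀ {i j} → f i ≡ f j → i ≡ j) →
                           ∀ n {u} → u < n → multiplicity (applyUpTo f n) (f u) ≡ 1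
  multiplicity-applyUpTo f f-inj (suc n) {zero} _ = cong₂ _+_ (𝟙-yes refl (f 0 ≟ f 0))
    (∑-zeroᴬ (All.applyUpTo⁺₂ (f ∘ suc) n (λ i e → 1+n≢0 (f-inj e))) (λ f1+i≢f0 → 𝟙-no f1+i≢f0 _))
  multiplicity-applyUpTo f f-inj (suc n) {suc u} (s≤s u<n) =
    cong₂ _+_ (𝟙-no (λ e → 1+n≢0 (f-inj (sym e))) (f 0 ≟ f (suc u)))
              (multiplicity-applyUpTo (f ∘ suc) (suc-injective ∘ f-inj) n u<n)

module _ {R : Rel A ℓ″} (R? : Binary.Decidable R) (R-sym : Binary.Symmetric R) (R-trans : Binary.Transitive R) where

  deduplicate-meets-class-once : ∀ y xs → Any (λ x → R x y) xs → ∑[ z ∈ deduplicate R? xs ] 𝟙 (R? z y) ≡ 1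
  deduplicate-meets-class-once y (x ∷ xs) x~y with R? x y
  ... | yes Rxy = cong suc (trans (∑-filter (¬? ∘ R? x) (deduplicate R? xs) _) (∑-zero (deduplicate R? xs) dropped))
    where
    dropped : ∀ z → 𝟙 (¬? (R? x z)) * 𝟙 (R? z y) ≡ 0
    dropped z with R? x z | R? z y
    ... | yes _    | _       = refl
    ... | no ¬Rxz  | yes Rzy = ⊥-elim (¬Rxz (R-trans Rxy (R-sym Rzy)))
    ... | no _     | no _    = refl
  ... | no ¬Rxy with x~y
  ...   | here Rxy  = ⊥-elim (¬Rxy Rxy)
  ...   | there xs~y = begin
    ∑ (filter (¬? ∘ R? x) (deduplicate R? xs)) (λ z → 𝟙 (R? z y))
      ≡⟨ ∑-filter (¬? ∘ R? x) (deduplicate R? xs) _ ⟩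
    ∑[ z ∈ deduplicate R? xs ] (𝟙 (¬? (R? x z)) * 𝟙 (R? z y))      ≡⟨ ∑-cong (deduplicate R? xs) kept ⟩
    ∑[ z ∈ deduplicate R? xs ] 𝟙 (R? z y)                          ≡⟨ deduplicate-meets-class-once y xs xs~y ⟩
    1                                                              ∎
    where
    open ≡-Reasoning
    kept : ∀ z → 𝟙 (¬? (R? x z)) * 𝟙 (R? z y) ≡ 𝟙 (R? z y)
    kept z with R? x z | R? z y
    ... | yes Rxz | yes Rzy = ⊥-elim (¬Rxy (R-trans Rxz Rzy))
    ... | yes _   | no _    = refl
    ... | no _    | d       = +-identityʳ (𝟙 d)

All-deduplicate : ∀ {P : A → Set ℓ} {R : Rel A ℓ″} (R? : Binary.Decidable R) {xs} →
                  All P xs → All P (deduplicate R? xs)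
All-deduplicate R? ps = All.tabulate (All.lookup ps ∘ Any.deduplicate⁻ R?)

module _ (_≟A_ : DecidableEquality A) (_≟B_ : DecidableEquality B) where
  private
    module MA = Multiplicity _≟A_
    module MB = Multiplicity _≟B_

  ∑𝟙-injection : ∀ {P : A → Set ℓ} {Q : B → Set ℓ′} {I : A → Set ℓ″}
    (P? : ∀ x → Dec (P x)) (Q? : ∀ y → Dec (Q y)) (xs : List A) (ys : List B) (f : B → A) →
    All I xs →
    (∀ {y} → Q y → MA.multiplicity xs (f y) ≡ 1) →
    (∀ {y} → Q y → MB.multiplicity ys y ≡ 1) →
    (∀ {y} → Q y → P (f y)) →
    (∀ {x} → I x → P x → Σ B λ y → Q y × f y ≡ x) →
    (∀ {y y′} → f y ≡ f y′ → y ≡ y′) →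
    ∑[ x ∈ xs ] 𝟙 (P? x) ≡ ∑[ y ∈ ys ] 𝟙 (Q? y)
  ∑𝟙-injection {I = I} P? Q? xs ys f I-xs once-xs once-ys f-P f-onto f-inj = begin
    ∑[ x ∈ xs ] 𝟙 (P? x)                                       ≡⟨ ∑-congᴬ I-xs by-preimage ⟩
    ∑[ x ∈ xs ] ∑[ y ∈ ys ] (𝟙 (P? x) * 𝟙 (Q? y ×-dec f y ≟A x))  ≡⟨ ∑-comm xs ys _ ⟩
    ∑[ y ∈ ys ] ∑[ x ∈ xs ] (𝟙 (P? x) * 𝟙 (Q? y ×-dec f y ≟A x))  ≡⟨ ∑-cong ys by-image ⟩
    ∑[ y ∈ ys ] 𝟙 (Q? y)                                       ∎
    where
    open ≡-Reasoning
    by-preimage : ∀ {x} → I x → 𝟙 (P? x) ≡ ∑[ y ∈ ys ] (𝟙 (P? x) * 𝟙 (Q? y ×-dec f y ≟A x))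
    by-preimage {x} Ix with P? x
    ... | no _   = sym (∑-zero ys (λ _ → refl))
    ... | yes Px = let y₀ , Qy₀ , fy₀≡x = f-onto Ix Px in sym (trans (∑-cong ys (λ y → +-identityʳ _))
      (MB.∑𝟙-unique (λ y → Q? y ×-dec f y ≟A x) ys y₀ (λ y (_ , fy≡x) → f-inj (trans fy≡x (sym fy₀≡x)))
                    (Qy₀ , fy₀≡x) (once-ys Qy₀)))
    by-image : ∀ y → ∑[ x ∈ xs ] (𝟙 (P? x) * 𝟙 (Q? y ×-dec f y ≟A x)) ≡ 𝟙 (Q? y)
    by-image y with Q? y
    ... | no _   = ∑-zero xs (λ x → *-zeroʳ (𝟙 (P? x)))
    ... | yes Qy = trans (∑-cong xs (λ x → sym (𝟙-×-dec (P? x) (yes Qy ×-dec f y ≟A x))))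
      (MA.∑𝟙-unique (λ x → P? x ×-dec (yes Qy ×-dec f y ≟A x)) xs (f y) (λ x (_ , _ , fy≡x) → sym fy≡x)
                    (f-P Qy , Qy , refl) (once-xs Qy))

infix 4 _≡_[mod_]

record _≡_[mod_] (a b N : ℕ) : Set where
  constructor congruent
  field
    x y : ℕ
    eq  : a + x * N ≡ b + y * N

module _ {N : ℕ} where

  mod-reflexive : ∀ {a b} → a ≡ b → a ≡ b [mod N ]
  mod-reflexive refl = congruent 0 0 refl

  mod-refl : ∀ {a} → a ≡ a [mod N ]
  mod-refl = mod-reflexive refl

  mod-sym : ∀ {a b} → a ≡ b [mod N ] → b ≡ a [mod N ]
  mod-sym (congruent x y e) = congruent y x (sym e)

  mod-trans : ∀ {a b c} → a ≡ b [mod N ] → b ≡ c [mod N ] → a ≡ c [mod N ]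
  mod-trans {a} {b} {c} (congruent x y e) (congruent u v f) = congruent (x + u) (y + v) (begin
    a + (x + u) * N       ≡⟨ solve (a L.∷ x L.∷ u L.∷ N L.∷ L.[]) ⟩
    (a + x * N) + u * N   ≡⟨ cong (_+ u * N) e ⟩
    (b + y * N) + u * N   ≡⟨ solve (b L.∷ y L.∷ u L.∷ N L.∷ L.[]) ⟩
    (b + u * N) + y * N   ≡⟨ cong (_+ y * N) f ⟩
    (c + v * N) + y * N   ≡⟨ solve (c L.∷ y L.∷ v L.∷ N L.∷ L.[]) ⟩
    c + (y + v) * N       ∎)
    where open ≡-Reasoning

  mod-isEquivalence : IsEquivalence (_≡_[mod N ])
  mod-isEquivalence = record { refl = mod-refl ; sym = mod-sym ; trans = mod-trans }

  mod-+ : ∀ {a b c d} → a ≡ b [mod N ] → c ≡ d [mod N ] → a + c ≡ b + d [mod N ]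
  mod-+ {a} {b} {c} {d} (congruent x y e) (congruent u v f) = congruent (x + u) (y + v) (begin
    a + c + (x + u) * N         ≡⟨ solve (a L.∷ c L.∷ x L.∷ u L.∷ N L.∷ L.[]) ⟩
    (a + x * N) + (c + u * N)   ≡⟨ cong₂ _+_ e f ⟩
    (b + y * N) + (d + v * N)   ≡⟨ solve (b L.∷ d L.∷ y L.∷ v L.∷ N L.∷ L.[]) ⟩
    b + d + (y + v) * N         ∎)
    where open ≡-Reasoning

  mod-+ˡ : ∀ c {a b} → a ≡ b [mod N ] → c + a ≡ c + b [mod N ]
  mod-+ˡ c = mod-+ (mod-refl {c})

  mod-+ʳ : ∀ c {a b} → a ≡ b [mod N ] → a + c ≡ b + c [mod N ]
  mod-+ʳ c e = mod-+ e (mod-refl {c})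

  mod-cancelʳ-+ : ∀ c {a b} → a + c ≡ b + c [mod N ] → a ≡ b [mod N ]
  mod-cancelʳ-+ c {a} {b} (congruent x y e) = congruent x y (+-cancelʳ-≡ c _ _ (begin
    a + x * N + c   ≡⟨ solve (a L.∷ x L.∷ N L.∷ c L.∷ L.[]) ⟩
    a + c + x * N   ≡⟨ e ⟩
    b + c + y * N   ≡⟨ solve (b L.∷ y L.∷ N L.∷ c L.∷ L.[]) ⟩
    b + y * N + c   ∎))
    where open ≡-Reasoning

  +*-mod : ∀ a k → a + k * N ≡ a [mod N ]
  +*-mod a k = congruent 0 k (+-identityʳ _)

  %-mod : .{{_ : NonZero N}} → ∀ a → a % N ≡ a [mod N ]
  %-mod a = congruent (a / N) 0 (trans (sym (m≡m%n+[m/n]*n a N)) (sym (+-identityʳ a)))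

  mod⇒%≡ : .{{_ : NonZero N}} → ∀ {a b} → a ≡ b [mod N ] → a % N ≡ b % N
  mod⇒%≡ {a} {b} (congruent x y e) = begin
    a % N             ≡⟨ [m+kn]%n≡m%n a x N ⟨
    (a + x * N) % N   ≡⟨ cong (_% N) e ⟩
    (b + y * N) % N   ≡⟨ [m+kn]%n≡m%n b y N ⟩
    b % N             ∎
    where open ≡-Reasoning

mod-setoid : ℕ → Setoid _ _
mod-setoid N = record { isEquivalence = mod-isEquivalence {N} }

mod-halve : ∀ {M a b} → a ≡ b [mod M + M ] → a ≡ b [mod M ]
mod-halve {M} {a} {b} (congruent x y e) = congruent (x + x) (y + y) (begin
  a + (x + x) * M   ≡⟨ solve (a L.∷ x L.∷ M L.∷ L.[]) ⟩
  a + x * (M + M)   ≡⟨ e ⟩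
  b + y * (M + M)   ≡⟨ solve (b L.∷ y L.∷ M L.∷ L.[]) ⟩
  b + (y + y) * M   ∎)
  where open ≡-Reasoning

mod-double : ∀ {M a b} → a ≡ b [mod M ] → Σ ℕ λ t → a + t * M ≡ b [mod M + M ]
mod-double {M} {a} {b} (congruent x y e) = x + y , congruent 0 y (begin
  a + (x + y) * M + 0 * (M + M)   ≡⟨ solve (a L.∷ x L.∷ y L.∷ M L.∷ L.[]) ⟩
  a + x * M + y * M               ≡⟨ cong (_+ y * M) e ⟩
  b + y * M + y * M               ≡⟨ solve (b L.∷ y L.∷ M L.∷ L.[]) ⟩
  b + y * (M + M)                 ∎)
  where open ≡-Reasoning

parity : ∀ k → Σ ℕ λ a → k ≡ a + a ⊎ k ≡ suc (a + a)
parity zero = 0 , inj₁ refl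
parity (suc k) with parity k
... | a , inj₁ refl = a , inj₂ refl
... | a , inj₂ refl = suc a , inj₁ (cong suc (sym (+-suc a a)))

double≢odd : ∀ a b → a + a ≢ suc (b + b)
double≢odd a b e =
  even≢odd a b (trans (cong (a +_) (+-identityʳ a)) (trans e (cong (λ z → suc (b + z)) (sym (+-identityʳ b)))))

double-injective : ∀ a b → a + a ≡ b + b → a ≡ b
double-injective a b e = trans (n≡⌊n+n/2⌋ a) (trans (cong ⌊_/2⌋ e) (sym (n≡⌊n+n/2⌋ b)))

double>0⇒>0 : ∀ {q} → 0 < q + q → 0 < q
double>0⇒>0 {suc q} _ = s≤s z≤n

double⇒2∣ : ∀ {k} a → k ≡ a + a → 2 ∣ k
double⇒2∣ a refl = divides a (trans (cong (a +_) (sym (+-identityʳ a))) (*-comm 2 a))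

2∣⇒double : ∀ {k} → 2 ∣ k → Σ ℕ λ a → k ≡ a + a
2∣⇒double (divides a refl) = a , trans (*-comm a 2) (cong (a +_) (+-identityʳ a))

odd⇒2∤ : ∀ {k} a → k ≡ suc (a + a) → ¬ 2 ∣ k
odd⇒2∤ a refl 2∣k with 2∣⇒double 2∣k
... | b , e = double≢odd b a (sym e)

odd-∣-double⇒∣ : ∀ {p h} → ¬ 2 ∣ p → p ∣ h + h → p ∣ h
odd-∣-double⇒∣ {p} {h} 2∤p p∣2h = coprime-divisor coprime (subst (p ∣_) (cong (h +_) (sym (+-identityʳ h))) p∣2h)
  where
  coprime : Coprime p 2
  coprime (d∣p , d∣2) with irreducible[2] d∣2
  ... | inj₁ d≡1 = d≡1
  ... | inj₂ refl = ⊥-elim (2∤p d∣p)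

∣∧<double⇒≡0⊎≡ : ∀ {p m} → p ∣ m → m < p + p → m ≡ 0 ⊎ m ≡ p
∣∧<double⇒≡0⊎≡ {p} (divides zero refl) _ = inj₁ refl
∣∧<double⇒≡0⊎≡ {p} (divides (suc zero) refl) _ = inj₂ (+-identityʳ p)
∣∧<double⇒≡0⊎≡ {p} (divides (suc (suc q)) refl) m<2p =
  ⊥-elim (<-irrefl refl (<-≤-trans m<2p (+-monoʳ-≤ p (≤-trans (≤-reflexive (sym (+-identityʳ p)))
                                                                 (+-monoʳ-≤ p z≤n)))))

at : Vec Bool n → ℕ → Bool
at []       a       = false
at (x ∷ xs) zero    = x
at (x ∷ xs) (suc a) = at xs a

at-lookup : ∀ (v : Vec Bool n) (i : Fin n) → at v (toℕ i) ≡ lookup v i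
at-lookup (x ∷ xs) fzero    = refl
at-lookup (x ∷ xs) (fsuc i) = at-lookup xs i

at-injective : ∀ (u v : Vec Bool n) → (∀ a → a < n → at u a ≡ at v a) → u ≡ v
at-injective []       []       e = refl
at-injective (x ∷ u) (y ∷ v) e = cong₂ _∷_ (e 0 (s≤s z≤n)) (at-injective u v (λ a a<n → e (suc a) (s≤s a<n)))

at-++ˡ : ∀ (u : Vec Bool m) (v : Vec Bool n) {a} → a < m → at (u ++ v) a ≡ at u a
at-++ˡ (x ∷ u) v {zero}  _         = refl
at-++ˡ (x ∷ u) v {suc a} (s≤s a<m) = at-++ˡ u v a<m

at-++ʳ : ∀ (u : Vec Bool m) (v : Vec Bool n) a → at (u ++ v) (m + a) ≡ at v a
at-++ʳ []      v a = refl
at-++ʳ (x ∷ u) v a = at-++ʳ u v a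

at-∷ʳ-< : ∀ (u : Vec Bool n) y {a} → a < n → at (u ∷ʳ y) a ≡ at u a
at-∷ʳ-< (x ∷ u) y {zero}  _         = refl
at-∷ʳ-< (x ∷ u) y {suc a} (s≤s a<n) = at-∷ʳ-< u y a<n

at-∷ʳ-last : ∀ (u : Vec Bool n) y → at (u ∷ʳ y) n ≡ y
at-∷ʳ-last []      y = refl
at-∷ʳ-last (x ∷ u) y = at-∷ʳ-last u y

at-reverse : ∀ (v : Vec Bool n) a b → suc (a + b) ≡ n → at (reverse v) a ≡ at v b
at-reverse {suc n} (x ∷ xs) a zero e = begin
  at (reverse (x ∷ xs)) a   ≡⟨ cong (λ v → at v a) (reverse-∷ x xs) ⟩
  at (reverse xs ∷ʳ x) a    ≡⟨ cong (at (reverse xs ∷ʳ x)) (trans (sym (+-identityʳ a)) (suc-injective e)) ⟩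
  at (reverse xs ∷ʳ x) n    ≡⟨ at-∷ʳ-last (reverse xs) x ⟩
  x                         ∎
  where open ≡-Reasoning
at-reverse {suc n} (x ∷ xs) a (suc b) e = begin
  at (reverse (x ∷ xs)) a   ≡⟨ cong (λ v → at v a) (reverse-∷ x xs) ⟩
  at (reverse xs ∷ʳ x) a    ≡⟨ at-∷ʳ-< (reverse xs) x (≤-trans (s≤s (m≤m+n a b)) (≤-reflexive e′)) ⟩
  at (reverse xs) a         ≡⟨ at-reverse xs a b e′ ⟩
  at xs b                   ∎
  where
  open ≡-Reasoning
  e′ : suc (a + b) ≡ n
  e′ = trans (sym (+-suc a b)) (suc-injective e)

blues-∷ʳ : ∀ (xs : Vec Bool n) y → blues (xs ∷ʳ y) ≡ blues (y ∷ xs)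
blues-∷ʳ []           y     = refl
blues-∷ʳ (true ∷ xs)  true  = cong suc (blues-∷ʳ xs true)
blues-∷ʳ (true ∷ xs)  false = cong suc (blues-∷ʳ xs false)
blues-∷ʳ (false ∷ xs) true  = blues-∷ʳ xs true
blues-∷ʳ (false ∷ xs) false = blues-∷ʳ xs false

blues-++ : ∀ (u : Vec Bool m) (v : Vec Bool n) → blues (u ++ v) ≡ blues u + blues v
blues-++ []          v = refl
blues-++ (true ∷ u)  v = cong suc (blues-++ u v)
blues-++ (false ∷ u) v = blues-++ u v

blues-reverse : ∀ (v : Vec Bool n) → blues (reverse v) ≡ blues v
blues-reverse []       = refl
blues-reverse (x ∷ xs) = begin
  blues (reverse (x ∷ xs))   ≡⟨ cong blues (reverse-∷ x xs) ⟩
  blues (reverse xs ∷ʳ x)    ≡⟨ blues-∷ʳ (reverse xs) x ⟩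
  blues (x ∷ reverse xs)     ≡⟨ blues-∷-cong x (blues-reverse xs) ⟩
  blues (x ∷ xs)             ∎
  where
  open ≡-Reasoning
  blues-∷-cong : ∀ {k} y {u v : Vec Bool k} → blues u ≡ blues v → blues (y ∷ u) ≡ blues (y ∷ v)
  blues-∷-cong true  e = cong suc e
  blues-∷-cong false e = e

∑-allColorings-suc : ∀ m (f : Coloring (suc m) → ℕ) →
  ∑ (allColorings (suc m)) f ≡ ∑[ v ∈ allColorings m ] f (true ∷ v) + ∑[ v ∈ allColorings m ] f (false ∷ v)
∑-allColorings-suc m f =
  trans (∑-++ (map (true ∷_) Cs) (map (false ∷_) Cs) f) (cong₂ _+_ (∑-map (true ∷_) Cs f) (∑-map (false ∷_) Cs f))
  where Cs = allColorings m

multiplicity-allColorings : ∀ m (c : Coloring m) → ∑[ x ∈ allColorings m ] 𝟙 (x ≟c c) ≡ 1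
multiplicity-allColorings zero    []      = refl
multiplicity-allColorings (suc m) (b ∷ c) = trans (∑-allColorings-suc m (λ x → 𝟙 (x ≟c (b ∷ c)))) (by b)
  where
  Cs : List (Coloring m)
  Cs = allColorings m
  head-matches : ∀ b → ∑[ v ∈ Cs ] 𝟙 ((b ∷ v) ≟c (b ∷ c)) ≡ 1
  head-matches b = trans (∑-cong Cs (λ v → 𝟙-⇔ ∷-injectiveʳ (cong (b ∷_)) _ (v ≟c c))) (multiplicity-allColorings m c)
  head-differs : ∀ b b′ → b ≢ b′ → ∑[ v ∈ Cs ] 𝟙 ((b ∷ v) ≟c (b′ ∷ c)) ≡ 0
  head-differs b b′ b≢b′ = ∑-zero Cs (λ v → 𝟙-no (b≢b′ ∘ proj₁ ∘ ∷-injective) _)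
  by : ∀ b → ∑[ v ∈ Cs ] 𝟙 ((true ∷ v) ≟c (b ∷ c)) + ∑[ v ∈ Cs ] 𝟙 ((false ∷ v) ≟c (b ∷ c)) ≡ 1
  by true  = cong₂ _+_ (head-matches true) (head-differs false true (λ ()))
  by false = cong₂ _+_ (head-differs true false (λ ())) (head-matches false)

multiplicity-Neck : ∀ {n j} (c : Coloring n) → blues c ≡ j → ∑[ x ∈ Neck n j ] 𝟙 (x ≟c c) ≡ 1
multiplicity-Neck {n} c refl = begin
  ∑[ x ∈ Neck n (blues c) ] 𝟙 (x ≟c c)
    ≡⟨ ∑-filter (λ x → blues x ≟ blues c) (allColorings n) _ ⟩
  ∑[ x ∈ allColorings n ] (𝟙 (blues x ≟ blues c) * 𝟙 (x ≟c c))   ≡⟨ ∑-cong (allColorings n) only-c ⟩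
  ∑[ x ∈ allColorings n ] 𝟙 (x ≟c c)                             ≡⟨ multiplicity-allColorings n c ⟩
  1                                                              ∎
  where
  open ≡-Reasoning
  only-c : ∀ x → 𝟙 (blues x ≟ blues c) * 𝟙 (x ≟c c) ≡ 𝟙 (x ≟c c)
  only-c x with x ≟c c
  ... | yes refl = cong (_* 1) (𝟙-yes refl (blues x ≟ blues x))
  ... | no _     = *-zeroʳ (𝟙 (blues x ≟ blues c))

All-Neck : ∀ n j → All (λ x → blues x ≡ j) (Neck n j)
All-Neck n j = All.all-filter (λ x → blues x ≟ j) (allColorings n)

count-blues : ∀ m k → ∑[ x ∈ allColorings m ] 𝟙 (blues x ≟ k) ≡ m C k
count-blues zero    zero    = refl
count-blues zero    (suc k) = refl
count-blues (suc m) k = trans (∑-allColorings-suc m (λ x → 𝟙 (blues x ≟ k))) (by k)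
  where
  Cs : List (Coloring m)
  Cs = allColorings m
  by : ∀ k → ∑[ v ∈ Cs ] 𝟙 (suc (blues v) ≟ k) + ∑[ v ∈ Cs ] 𝟙 (blues v ≟ k) ≡ suc m C k
  by zero    = cong₂ _+_ (∑-zero Cs (λ v → 𝟙-no (λ ()) (suc (blues v) ≟ 0))) (count-blues m 0)
  by (suc k) = trans
    (cong₂ _+_ (trans (∑-cong Cs (λ v → 𝟙-⇔ suc-injective (cong suc) _ (blues v ≟ k))) (count-blues m k))
               (count-blues m (suc k)))
    (nCk+nC[k+1]≡[n+1]C[k+1] m k)

rot^-+ : ∀ a b (c : Coloring n) → rot^ (a + b) c ≡ rot^ a (rot^ b c)
rot^-+ zero    b c = refl
rot^-+ (suc a) b c = cong rot (rot^-+ a b c)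

rot^-comm : ∀ a b (c : Coloring n) → rot^ a (rot^ b c) ≡ rot^ b (rot^ a c)
rot^-comm a b c = trans (sym (rot^-+ a b c)) (trans (cong (λ k → rot^ k c) (+-comm a b)) (rot^-+ b a c))

Periodic : ℕ → Coloring n → Set
Periodic s c = rot^ s c ≡ c

Periodic-+ : ∀ {c : Coloring n} s t → Periodic s c → Periodic t c → Periodic (s + t) c
Periodic-+ {c = c} s t ps pt = trans (rot^-+ s t c) (trans (cong (rot^ s) pt) ps)

Periodic-* : ∀ {c : Coloring n} q {s} → Periodic s c → Periodic (q * s) c
Periodic-* zero    ps = refl
Periodic-* (suc q) {s} ps = Periodic-+ s (q * s) ps (Periodic-* q ps)

Periodic-∸ : ∀ {c : Coloring n} s t → Periodic s c → Periodic (s + t) c → Periodic t c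
Periodic-∸ {c = c} s t ps pst = begin
  rot^ t c            ≡⟨ cong (rot^ t) ps ⟨
  rot^ t (rot^ s c)   ≡⟨ rot^-+ t s c ⟨
  rot^ (t + s) c      ≡⟨ cong (λ k → rot^ k c) (+-comm t s) ⟩
  rot^ (s + t) c      ≡⟨ pst ⟩
  c                   ∎
  where open ≡-Reasoning

Periodic-rot^ : ∀ {c : Coloring n} s t → Periodic s c → Periodic s (rot^ t c)
Periodic-rot^ {c = c} s t ps = trans (rot^-comm s t c) (cong (rot^ t) ps)

record LeastPeriod (c : Coloring n) : Set where
  field
    period   : ℕ
    period>0 : 0 < period
    periodic : Periodic period c
    least    : ∀ s → 0 < s → s < period → ¬ Periodic s c

LeastPeriod-transfer : ∀ {c : Coloring n} {d : Coloring m} →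
  (∀ s → Periodic s c → Periodic s d) → (∀ s → Periodic s d → Periodic s c) → LeastPeriod c → LeastPeriod d
LeastPeriod-transfer c⇒d d⇒c p = record
  { period = period ; period>0 = period>0 ; periodic = c⇒d period periodic
  ; least = λ s s>0 s<p ps → least s s>0 s<p (d⇒c s ps) }
  where open LeastPeriod p

leastPositive : ∀ {P : ℕ → Set} → (∀ k → Dec (P k)) → ∀ m →
  (∀ s → 0 < s → s ≤ m → ¬ P s) ⊎ (Σ ℕ λ q → 0 < q × P q × (∀ s → 0 < s → s < q → ¬ P s))
leastPositive P? zero = inj₁ (λ s s>0 s≤0 _ → <-irrefl refl (<-≤-trans s>0 s≤0))
leastPositive P? (suc m) with leastPositive P? m
... | inj₂ found = inj₂ found
... | inj₁ none with P? (suc m)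
...   | yes Pm = inj₂ (suc m , s≤s z≤n , Pm , λ s s>0 s≤m → none s s>0 (s≤s⁻¹ s≤m))
...   | no ¬Pm = inj₁ λ s s>0 s≤1+m →
  [ (λ s<1+m → none s s>0 (s≤s⁻¹ s<1+m)) , (λ { refl → ¬Pm }) ]′ (m≤n⇒m<n∨m≡n s≤1+m)

module Cyclic (N′ : ℕ) where

  N : ℕ
  N = suc N′

  bead : Coloring N → ℕ → Bool
  bead c a = at c (a % N)

  at-% : ∀ (v : Coloring N) a → at v (a % N) ≡ lookup v (a mod N)
  at-% v a = trans (cong (at v) (sym (toℕ-fromℕ< (m%n<n a N)))) (at-lookup v (a mod N))

  bead-cong : ∀ (c : Coloring N) {a b} → a ≡ b [mod N ] → bead c a ≡ bead c b
  bead-cong c a≡b = cong (at c) (mod⇒%≡ a≡b)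

  bead-< : ∀ (c : Coloring N) {a} → a < N → bead c a ≡ at c a
  bead-< c a<N = cong (at c) (m<n⇒m%n≡m a<N)

  bead-injective : ∀ (c d : Coloring N) → (∀ a → bead c a ≡ bead d a) → c ≡ d
  bead-injective c d e = at-injective c d (λ a a<N → trans (sym (bead-< c a<N)) (trans (e a) (bead-< d a<N)))

  +N-mod : ∀ a → a + N ≡ a [mod N ]
  +N-mod a = congruent 0 1 (trans (+-identityʳ _) (cong (a +_) (sym (+-identityʳ N))))

  bead-rot : ∀ (c : Coloring N) a → bead (rot c) a ≡ bead c (a + N′)
  bead-rot c a = begin
    at (rot c) (a % N)                      ≡⟨ at-% (rot c) a ⟩
    lookup (rot c) (a mod N)                ≡⟨ lookup∘tabulate (λ m → lookup c (modF m (toℕ m + N′))) (a mod N) ⟩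
    lookup c ((toℕ (a mod N) + N′) mod N)   ≡⟨ at-% c (toℕ (a mod N) + N′) ⟨
    bead c (toℕ (a mod N) + N′)             ≡⟨ cong (λ z → bead c (z + N′)) (toℕ-fromℕ< (m%n<n a N)) ⟩
    bead c (a % N + N′)                     ≡⟨ bead-cong c (mod-+ʳ N′ (%-mod a)) ⟩
    bead c (a + N′)                         ∎
    where open ≡-Reasoning

  bead-rot^ : ∀ (c : Coloring N) k a → bead (rot^ k c) a ≡ bead c (a + k * N′)
  bead-rot^ c zero    a = cong (bead c) (sym (+-identityʳ a))
  bead-rot^ c (suc k) a = begin
    bead (rot (rot^ k c)) a     ≡⟨ bead-rot (rot^ k c) a ⟩
    bead (rot^ k c) (a + N′)    ≡⟨ bead-rot^ c k (a + N′) ⟩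
    bead c (a + N′ + k * N′)    ≡⟨ cong (bead c) (+-assoc a N′ (k * N′)) ⟩
    bead c (a + suc k * N′)     ∎
    where open ≡-Reasoning

  bead-refl-k : ∀ (c : Coloring N) k a → bead (refl-k k c) a ≡ bead c (k + N ∸ a % N)
  bead-refl-k c k a = begin
    at (refl-k k c) (a % N)                    ≡⟨ at-% (refl-k k c) a ⟩
    lookup (refl-k k c) (a mod N)              ≡⟨ lookup∘tabulate (λ m → lookup c (modF m (k + N ∸ toℕ m))) (a mod N) ⟩
    lookup c ((k + N ∸ toℕ (a mod N)) mod N)   ≡⟨ at-% c (k + N ∸ toℕ (a mod N)) ⟨
    bead c (k + N ∸ toℕ (a mod N))             ≡⟨ cong (λ z → bead c (k + N ∸ z)) (toℕ-fromℕ< (m%n<n a N)) ⟩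
    bead c (k + N ∸ a % N)                     ∎
    where open ≡-Reasoning

  refl-k-index : ∀ k a → (k + N ∸ a % N) + a ≡ k [mod N ]
  refl-k-index k a = begin
    (k + N ∸ a % N) + a       ≈⟨ mod-+ˡ (k + N ∸ a % N) (mod-sym (%-mod a)) ⟩
    (k + N ∸ a % N) + a % N   ≡⟨ m∸n+n≡m (≤-trans (m%n≤n a N) (m≤n+m N k)) ⟩
    k + N                     ≈⟨ +N-mod k ⟩
    k                         ∎
    where open SetoidReasoning (mod-setoid N)

  Periodic-N : ∀ (c : Coloring N) → Periodic N c
  Periodic-N c = bead-injective _ _ λ a → begin
    bead (rot^ N c) a     ≡⟨ bead-rot^ c N a ⟩
    bead c (a + N * N′)   ≡⟨ bead-cong c (mod-trans (mod-reflexive (cong (a +_) (*-comm N N′))) (+*-mod a N′)) ⟩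
    bead c a              ∎
    where open ≡-Reasoning

  rot^-% : ∀ (c : Coloring N) k → rot^ k c ≡ rot^ (k % N) c
  rot^-% c k = begin
    rot^ k c                              ≡⟨ cong (λ z → rot^ z c) (m≡m%n+[m/n]*n k N) ⟩
    rot^ (k % N + (k / N) * N) c          ≡⟨ rot^-+ (k % N) ((k / N) * N) c ⟩
    rot^ (k % N) (rot^ ((k / N) * N) c)   ≡⟨ cong (rot^ (k % N)) (Periodic-* (k / N) (Periodic-N c)) ⟩
    rot^ (k % N) c                        ∎
    where open ≡-Reasoning

  rot^-inverse : ∀ (c : Coloring N) t → rot^ (t * N′) (rot^ t c) ≡ c
  rot^-inverse c t = begin
    rot^ (t * N′) (rot^ t c)   ≡⟨ rot^-+ (t * N′) t c ⟨
    rot^ (t * N′ + t) c        ≡⟨ cong (λ z → rot^ z c) (trans (+-comm (t * N′) t) (sym (*-suc t N′))) ⟩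
    rot^ (t * N) c             ≡⟨ Periodic-* t (Periodic-N c) ⟩
    c                          ∎
    where open ≡-Reasoning

  Periodic-rot^⁻ : ∀ (c : Coloring N) s t → Periodic s (rot^ t c) → Periodic s c
  Periodic-rot^⁻ c s t ps = subst (Periodic s) (rot^-inverse c t) (Periodic-rot^ s (t * N′) ps)

  Periodic⇒bead-shift : ∀ (c : Coloring N) {s} → Periodic s c → ∀ a → bead c (a + s) ≡ bead c a
  Periodic⇒bead-shift c {s} ps a = begin
    bead c (a + s)              ≡⟨ cong (λ z → bead z (a + s)) ps ⟨
    bead (rot^ s c) (a + s)     ≡⟨ bead-rot^ c s (a + s) ⟩
    bead c (a + s + s * N′)     ≡⟨ cong (bead c) (trans (+-assoc a s (s * N′)) (cong (a +_) (sym (*-suc s N′)))) ⟩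
    bead c (a + s * N)          ≡⟨ bead-cong c (+*-mod a s) ⟩
    bead c a                    ∎
    where open ≡-Reasoning

  bead-shift⇒Periodic : ∀ (c : Coloring N) {s} → (∀ a → bead c (a + s) ≡ bead c a) → Periodic s c
  bead-shift⇒Periodic c {s} shift = bead-injective _ _ λ a → begin
    bead (rot^ s c) a          ≡⟨ bead-rot^ c s a ⟩
    bead c (a + s * N′)        ≡⟨ shift (a + s * N′) ⟨
    bead c (a + s * N′ + s)    ≡⟨ cong (bead c) (trans (+-assoc a (s * N′) s) (cong (a +_) (+-comm (s * N′) s))) ⟩
    bead c (a + (s + s * N′))  ≡⟨ cong (λ z → bead c (a + z)) (*-suc s N′) ⟨
    bead c (a + s * N)         ≡⟨ bead-cong c (+*-mod a s) ⟩
    bead c a                   ∎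
    where open ≡-Reasoning

  Symmetric : ℕ → Coloring N → Set
  Symmetric k c = ∀ a b → a + b ≡ k [mod N ] → bead c a ≡ bead c b

  Symmetric⇒refl-k : ∀ k (c : Coloring N) → Symmetric k c → refl-k k c ≡ c
  Symmetric⇒refl-k k c sym-c = bead-injective _ _ λ a →
    trans (bead-refl-k c k a) (sym-c _ a (refl-k-index k a))

  refl-k⇒Symmetric : ∀ k (c : Coloring N) → refl-k k c ≡ c → Symmetric k c
  refl-k⇒Symmetric k c fixed a b a+b≡k = begin
    bead c a                 ≡⟨ cong (λ z → bead z a) fixed ⟨
    bead (refl-k k c) a      ≡⟨ bead-refl-k c k a ⟩
    bead c (k + N ∸ a % N)   ≡⟨ bead-cong c (mod-cancelʳ-+ a index) ⟩
    bead c b                 ∎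
    where
    open ≡-Reasoning
    index : (k + N ∸ a % N) + a ≡ b + a [mod N ]
    index = mod-trans (refl-k-index k a) (mod-trans (mod-sym a+b≡k) (mod-reflexive (+-comm a b)))

  Symmetric-cong : ∀ {k l} (c : Coloring N) → k ≡ l [mod N ] → Symmetric k c → Symmetric l c
  Symmetric-cong c k≡l sym-c a b a+b≡l = sym-c a b (mod-trans a+b≡l (mod-sym k≡l))

  Symmetric-rot^ : ∀ k (c : Coloring N) t → Symmetric k c → Symmetric (k + (t + t)) (rot^ t c)
  Symmetric-rot^ k c t sym-c a b a+b≡k+2t =
    trans (bead-rot^ c t a) (trans (sym-c (a + t * N′) (b + t * N′) index) (sym (bead-rot^ c t b)))
    where
    open SetoidReasoning (mod-setoid N)
    index : (a + t * N′) + (b + t * N′) ≡ k [mod N ]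
    index = begin
      (a + t * N′) + (b + t * N′)       ≡⟨ solve (a L.∷ b L.∷ t L.∷ N′ L.∷ L.[]) ⟩
      (a + b) + (t * N′ + t * N′)       ≈⟨ mod-+ʳ (t * N′ + t * N′) a+b≡k+2t ⟩
      k + (t + t) + (t * N′ + t * N′)   ≡⟨ solve (k L.∷ t L.∷ N′ L.∷ L.[]) ⟩
      k + ((t + t) + (t + t) * N′)      ≡⟨ cong (k +_) (*-suc (t + t) N′) ⟨
      k + (t + t) * N                   ≈⟨ +*-mod k (t + t) ⟩
      k                                 ∎

  s+N′*s≡s*N : ∀ s → s + N′ * s ≡ s * N
  s+N′*s≡s*N s = trans (cong (s +_) (*-comm N′ s)) (sym (*-suc s N′))

  Symmetric-+Periodic : ∀ k s (c : Coloring N) → Symmetric k c → Periodic s c → Symmetric (k + s) c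
  Symmetric-+Periodic k s c sym-c ps a b a+b≡k+s =
    trans (sym-c a (b + N′ * s) index) (Periodic⇒bead-shift c (Periodic-* N′ ps) b)
    where
    open SetoidReasoning (mod-setoid N)
    index : a + (b + N′ * s) ≡ k [mod N ]
    index = begin
      a + (b + N′ * s)   ≡⟨ +-assoc a b (N′ * s) ⟨
      a + b + N′ * s     ≈⟨ mod-+ʳ (N′ * s) a+b≡k+s ⟩
      k + s + N′ * s     ≡⟨ trans (+-assoc k s (N′ * s)) (cong (k +_) (s+N′*s≡s*N s)) ⟩
      k + s * N          ≈⟨ +*-mod k s ⟩
      k                  ∎

  -- N′ ≡ −1 (mod N): multiplying by N′ negates, which expresses R⁻ᵗ and the flip without subtraction.
  *N′-mod : ∀ a → a + a * N′ ≡ 0 [mod N ]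
  *N′-mod a = congruent 0 a (trans (+-identityʳ _) (sym (*-suc a N′)))

  bead-flip : ∀ (c : Coloring N) a b → a + b ≡ 0 [mod N ] → bead (flip c) a ≡ bead c b
  bead-flip c a b a+b≡0 = trans (bead-refl-k c 0 a) (bead-cong c (mod-cancelʳ-+ a index))
    where
    index : (N ∸ a % N) + a ≡ b + a [mod N ]
    index = mod-trans (refl-k-index 0 a) (mod-trans (mod-sym a+b≡0) (mod-reflexive (+-comm a b)))

  *N′*N′-mod : ∀ k → k * N′ * N′ ≡ k [mod N ]
  *N′*N′-mod k = congruent k (k * N′) (begin
    k * N′ * N′ + k * N          ≡⟨ cong (k * N′ * N′ +_) (*-suc k N′) ⟩
    k * N′ * N′ + (k + k * N′)   ≡⟨ solve (k L.∷ N′ L.∷ L.[]) ⟩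
    k + (k * N′ + k * N′ * N′)   ≡⟨ cong (k +_) (*-suc (k * N′) N′) ⟨
    k + k * N′ * N               ∎)
    where open ≡-Reasoning

  Symmetric⇒flip≡rot^ : ∀ k (c : Coloring N) → Symmetric k c → flip c ≡ rot^ (k * N′) c
  Symmetric⇒flip≡rot^ k c sym-c = bead-injective _ _ λ a → begin
    bead (flip c) a            ≡⟨ bead-flip c a (a * N′) (*N′-mod a) ⟩
    bead c (a * N′)            ≡⟨ sym-c (a * N′) (a + k * N′ * N′) (index a) ⟩
    bead c (a + k * N′ * N′)   ≡⟨ bead-rot^ c (k * N′) a ⟨
    bead (rot^ (k * N′) c) a   ∎
    where
    open ≡-Reasoning
    index : ∀ a → a * N′ + (a + k * N′ * N′) ≡ k [mod N ]
    index a = mod-trans {b = (a + a * N′) + k * N′ * N′} (mod-reflexive (solve (a L.∷ k L.∷ N′ L.∷ L.[])))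
                        (mod-trans (mod-+ʳ (k * N′ * N′) (*N′-mod a)) (*N′*N′-mod k))

  flip≡rot^⇒Symmetric : ∀ (c : Coloring N) u → flip c ≡ rot^ u c → Symmetric (u * N′) c
  flip≡rot^⇒Symmetric c u flip≡ a b a+b≡uN′ = begin
    bead c a                       ≡⟨ bead-cong c index ⟨
    bead c (b * N′ + u * N′)       ≡⟨ bead-rot^ c u (b * N′) ⟨
    bead (rot^ u c) (b * N′)       ≡⟨ cong (λ d → bead d (b * N′)) flip≡ ⟨
    bead (flip c) (b * N′)         ≡⟨ bead-flip c (b * N′) b (mod-trans (mod-reflexive (+-comm (b * N′) b))
                                                                        (*N′-mod b)) ⟩
    bead c b                       ∎
    where
    open ≡-Reasoning
    index : b * N′ + u * N′ ≡ a [mod N ]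
    index = mod-cancelʳ-+ b
      (mod-trans {b = u * N′ + (b + b * N′)} (mod-reflexive (solve (b L.∷ u L.∷ N′ L.∷ L.[])))
      (mod-trans (mod-+ˡ (u * N′) (*N′-mod b))
      (mod-trans (mod-reflexive (+-identityʳ (u * N′))) (mod-sym a+b≡uN′))))

  leastPeriod : ∀ (c : Coloring N) → LeastPeriod c
  leastPeriod c with leastPositive (λ k → rot^ k c ≟c c) N
  ... | inj₁ none = ⊥-elim (none N (s≤s z≤n) ≤-refl (Periodic-N c))
  ... | inj₂ (q , q>0 , periodic , least) = record { period = q ; period>0 = q>0 ; periodic = periodic ; least = least }

  module _ {c : Coloring N} (P : LeastPeriod c) where
    open LeastPeriod P
    private instance
      period-nonZero : NonZero period
      period-nonZero = >-nonZero period>0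

    Periodic⇒period∣ : ∀ {s} → Periodic s c → period ∣ s
    Periodic⇒period∣ {s} ps with s % period in s%p≡r
    ... | zero  = m%n≡0⇒n∣m s period s%p≡r
    ... | suc r = ⊥-elim (least (s % period) (subst (0 <_) (sym s%p≡r) (s≤s z≤n)) (m%n<n s period) remainder-periodic)
      where
      remainder-periodic : Periodic (s % period) c
      remainder-periodic = Periodic-∸ ((s / period) * period) (s % period) (Periodic-* (s / period) periodic)
        (subst (λ z → Periodic z c) (trans (m≡m%n+[m/n]*n s period) (+-comm (s % period) _)) ps)

    period∣⇒Periodic : ∀ {s} → period ∣ s → Periodic s c
    period∣⇒Periodic (divides q refl) = Periodic-* q periodic

    period≤N : period ≤ N
    period≤N = ∣⇒≤ (Periodic⇒period∣ (Periodic-N c))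

    rot^-%period : ∀ t → rot^ t c ≡ rot^ (t % period) c
    rot^-%period t = begin
      rot^ t c                                        ≡⟨ cong (λ z → rot^ z c) (m≡m%n+[m/n]*n t period) ⟩
      rot^ (t % period + (t / period) * period) c     ≡⟨ rot^-+ (t % period) ((t / period) * period) c ⟩
      rot^ (t % period) (rot^ ((t / period) * period) c) ≡⟨ cong (rot^ (t % period)) (Periodic-* (t / period) periodic) ⟩
      rot^ (t % period) c                             ∎
      where open ≡-Reasoning

    rot^-injective-≤ : ∀ {a b} → a ≤ b → b < period → rot^ a c ≡ rot^ b c → a ≡ b
    rot^-injective-≤ {a} {b} a≤b b<p e with b ∸ a in gap
    ... | zero  = ≤-antisym a≤b (m∸n≡0⇒m≤n gap)
    ... | suc d = ⊥-elim (least (suc d) (s≤s z≤n) (≤-<-trans (≤-trans (≤-reflexive (sym gap)) (m∸n≤m b a)) b<p)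
                    (Periodic-rot^⁻ c (suc d) a (begin
      rot^ (suc d) (rot^ a c)   ≡⟨ rot^-+ (suc d) a c ⟨
      rot^ (suc d + a) c        ≡⟨ cong (λ z → rot^ (z + a) c) gap ⟨
      rot^ (b ∸ a + a) c        ≡⟨ cong (λ z → rot^ z c) (m∸n+n≡m a≤b) ⟩
      rot^ b c                  ≡⟨ e ⟨
      rot^ a c                  ∎)))
      where open ≡-Reasoning

    rot^-injective : ∀ {a b} → a < period → b < period → rot^ a c ≡ rot^ b c → a ≡ b
    rot^-injective {a} {b} a<p b<p e with ≤-total a b
    ... | inj₁ a≤b = rot^-injective-≤ a≤b b<p e
    ... | inj₂ b≤a = sym (rot^-injective-≤ b≤a a<p (sym e))

  LeastPeriod-rot^ : ∀ (c : Coloring N) t → LeastPeriod c → LeastPeriod (rot^ t c)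
  LeastPeriod-rot^ c t = LeastPeriod-transfer (λ s → Periodic-rot^ s t) (λ s → Periodic-rot^⁻ c s t)

  rot-∷ʳ : ∀ (xs : Vec Bool N′) y → rot (xs ∷ʳ y) ≡ y ∷ xs
  rot-∷ʳ xs y = at-injective _ _ at-rot
    where
    open ≡-Reasoning
    at-rot : ∀ a → a < N → at (rot (xs ∷ʳ y)) a ≡ at (y ∷ xs) a
    at-rot zero a<N = begin
      at (rot (xs ∷ʳ y)) 0      ≡⟨ bead-< (rot (xs ∷ʳ y)) a<N ⟨
      bead (rot (xs ∷ʳ y)) 0    ≡⟨ bead-rot (xs ∷ʳ y) 0 ⟩
      bead (xs ∷ʳ y) N′         ≡⟨ bead-< (xs ∷ʳ y) ≤-refl ⟩
      at (xs ∷ʳ y) N′           ≡⟨ at-∷ʳ-last xs y ⟩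
      y                         ∎
    at-rot (suc b) (s≤s b<N′) = begin
      at (rot (xs ∷ʳ y)) (suc b)     ≡⟨ bead-< (rot (xs ∷ʳ y)) (s≤s b<N′) ⟨
      bead (rot (xs ∷ʳ y)) (suc b)   ≡⟨ bead-rot (xs ∷ʳ y) (suc b) ⟩
      bead (xs ∷ʳ y) (suc b + N′)    ≡⟨ bead-cong (xs ∷ʳ y) (mod-trans (mod-reflexive (sym (+-suc b N′)))
                                                                       (+N-mod b)) ⟩
      bead (xs ∷ʳ y) b               ≡⟨ bead-< (xs ∷ʳ y) (m<n⇒m<1+n b<N′) ⟩
      at (xs ∷ʳ y) b                 ≡⟨ at-∷ʳ-< xs y b<N′ ⟩
      at xs b                        ∎

  blues-rot : ∀ (c : Coloring N) → blues (rot c) ≡ blues c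
  blues-rot c with initLast c
  ... | xs , y , refl = trans (cong blues (rot-∷ʳ xs y)) (sym (blues-∷ʳ xs y))

  blues-rot^ : ∀ (c : Coloring N) k → blues (rot^ k c) ≡ blues c
  blues-rot^ c zero    = refl
  blues-rot^ c (suc k) = trans (blues-rot (rot^ k c)) (blues-rot^ c k)

  Rotated : Coloring N → Coloring N → Set
  Rotated c d = Σ ℕ λ k → d ≡ rot^ k c

  Rotated⇒InOrbit : ∀ {c d} → Rotated c d → InOrbit c d
  Rotated⇒InOrbit {c} (k , refl) = Any.map⁺ (Any.applyUpTo⁺ id (rot^-% c k) (m%n<n k N))

  InOrbit⇒Rotated : ∀ {c d} → InOrbit c d → Rotated c d
  InOrbit⇒Rotated d∈ with Any.applyUpTo⁻ id (Any.map⁻ d∈)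
  ... | k , _ , d≡ = k , d≡

  Rotated-sym : ∀ {c d} → Rotated c d → Rotated d c
  Rotated-sym {c} (k , refl) = k * N′ , sym (rot^-inverse c k)

  Rotated-trans : ∀ {c d e} → Rotated c d → Rotated d e → Rotated c e
  Rotated-trans {c} (k , refl) (l , refl) = l + k , sym (rot^-+ l k c)

  orbitSize≡period : ∀ (c : Coloring N) (P : LeastPeriod c) → orbitSize c ≡ LeastPeriod.period P
  orbitSize≡period c P = begin
    length D                                              ≡⟨ length≡∑1 D ⟩
    ∑[ r ∈ D ] 1                                          ≡⟨ ∑-congᴬ D-rotated hits-once ⟩
    ∑[ r ∈ D ] ∑[ k ∈ upTo p ] 𝟙 (r ≟c rot^ k c)          ≡⟨ ∑-comm D (upTo p) _ ⟩
    ∑[ k ∈ upTo p ] ∑[ r ∈ D ] 𝟙 (r ≟c rot^ k c)          ≡⟨ ∑-congᴬ (All.applyUpTo⁺₁ id p id) kept-once ⟩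
    ∑[ k ∈ upTo p ] 1                                     ≡⟨ length≡∑1 (upTo p) ⟨
    length (upTo p)                                       ≡⟨ length-upTo p ⟩
    p                                                     ∎
    where
    open ≡-Reasoning
    open LeastPeriod P renaming (period to p)
    open Multiplicity _≟_
    instance
      p-nonZero : NonZero p
      p-nonZero = >-nonZero period>0
    D : List (Coloring N)
    D = deduplicate _≟c_ (orbitList c)
    D-rotated : All (Rotated c) D
    D-rotated = All.tabulate (λ r∈D → InOrbit⇒Rotated (Any.deduplicate⁻ _≟c_ r∈D))
    hits-once : ∀ {r} → Rotated c r → 1 ≡ ∑[ k ∈ upTo p ] 𝟙 (r ≟c rot^ k c)
    hits-once (t , refl) = sym (trans
      (∑-congᴬ (All.applyUpTo⁺₁ id p id)
               (λ k<p → 𝟙-⇔ (at-index k<p) (λ { refl → rot^-%period P t }) _ (_ ≟ t % p)))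
      (multiplicity-applyUpTo id id p (m%n<n t p)))
      where
      at-index : ∀ {k} → k < p → rot^ t c ≡ rot^ k c → k ≡ t % p
      at-index k<p e = rot^-injective P k<p (m%n<n t p) (trans (sym e) (rot^-%period P t))
    kept-once : ∀ {k} → k < p → ∑[ r ∈ D ] 𝟙 (r ≟c rot^ k c) ≡ 1
    kept-once {k} k<p = deduplicate-meets-class-once _≟c_ sym trans (rot^ k c) (orbitList c)
      (Any.map⁺ (Any.applyUpTo⁺ id {k} refl (≤-trans k<p (period≤N P))))

  Symmetric-axes⇒Periodic : ∀ k s (c : Coloring N) → Symmetric k c → Symmetric (k + s) c → Periodic s c
  Symmetric-axes⇒Periodic k s c sym-k sym-k+s = bead-shift⇒Periodic c λ a →
    trans (sym-k+s (a + s) (k + a * N′) (index a)) (sym (sym-k a (k + a * N′) (index₀ a)))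
    where
    index₀ : ∀ a → a + (k + a * N′) ≡ k [mod N ]
    index₀ a = mod-trans {b = (a + a * N′) + k} (mod-reflexive (solve (a L.∷ k L.∷ N′ L.∷ L.[])))
                         (mod-+ʳ k (*N′-mod a))
    index : ∀ a → a + s + (k + a * N′) ≡ k + s [mod N ]
    index a = mod-trans {b = a + (k + a * N′) + s} (mod-reflexive (solve (a L.∷ s L.∷ k L.∷ N′ L.∷ L.[])))
                        (mod-+ʳ s (index₀ a))

  Symmetric-rot^⁻ : ∀ k (c : Coloring N) t → Symmetric k (rot^ t c) → Symmetric (k + (t * N′ + t * N′)) c
  Symmetric-rot^⁻ k c t sym-c = subst (Symmetric _) (rot^-inverse c t) (Symmetric-rot^ k (rot^ t c) (t * N′) sym-c)

  Symmetric-rot^⇒Periodic : ∀ k (c : Coloring N) t → Symmetric k c → Symmetric k (rot^ t c) → Periodic (t + t) c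
  Symmetric-rot^⇒Periodic k c t sym-c sym-tc = Periodic-∸ (t * N′ + t * N′) (t + t)
    (Symmetric-axes⇒Periodic k _ c sym-c (Symmetric-rot^⁻ k c t sym-tc))
    (subst (λ z → Periodic z c) 2tN≡ (Periodic-* (t + t) (Periodic-N c)))
    where
    2tN≡ : (t + t) * N ≡ (t * N′ + t * N′) + (t + t)
    2tN≡ = trans (*-suc (t + t) N′) (solve (t L.∷ N′ L.∷ L.[]))

  Periodic⇒Symmetric-rot^ : ∀ k (c : Coloring N) t → Symmetric k c → Periodic (t + t) c → Symmetric k (rot^ t c)
  Periodic⇒Symmetric-rot^ k c t sym-c p2t = Symmetric-cong (rot^ t c) index
    (Symmetric-+Periodic (k + (t + t)) (N′ * (t + t)) (rot^ t c) (Symmetric-rot^ k c t sym-c)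
      (Periodic-rot^ (N′ * (t + t)) t (Periodic-* N′ p2t)))
    where
    index : k + (t + t) + N′ * (t + t) ≡ k [mod N ]
    index = mod-trans (mod-reflexive (trans (+-assoc k (t + t) _) (cong (k +_) (s+N′*s≡s*N (t + t)))))
                      (+*-mod k (t + t))

  Symmetric-rot^⇒FFixed : ∀ k (r : Coloring N) t → Symmetric k (rot^ t r) → FFixed r
  Symmetric-rot^⇒FFixed k r t sym-tr =
    Rotated⇒InOrbit (axis * N′ , Symmetric⇒flip≡rot^ axis r (Symmetric-rot^⁻ k r t sym-tr))
    where
    axis : ℕ
    axis = k + (t * N′ + t * N′)

  FFixed⇒Symmetric : ∀ (r : Coloring N) → FFixed r → Σ ℕ λ k → Symmetric k r
  FFixed⇒Symmetric r f with InOrbit⇒Rotated f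
  ... | u , flip≡ = u * N′ , flip≡rot^⇒Symmetric r u flip≡

  Symmetric-∸period : ∀ {k p} y (c : Coloring N) → Periodic p c → p ≤ N → Symmetric (k + p * y) c → Symmetric k c
  Symmetric-∸period {k} {p} y c pp p≤N sym-c =
    Symmetric-cong c index (Symmetric-+Periodic _ _ c sym-c (Periodic-* y pN∸p))
    where
    pN∸p : Periodic (N ∸ p) c
    pN∸p = Periodic-∸ p (N ∸ p) pp (subst (λ z → Periodic z c) (sym (m+[n∸m]≡n p≤N)) (Periodic-N c))
    index : k + p * y + y * (N ∸ p) ≡ k [mod N ]
    index = mod-trans {b = k + y * N}
      (mod-reflexive (trans (regroup k p y (N ∸ p)) (cong (λ z → k + y * z) (m+[n∸m]≡n p≤N))))
      (+*-mod k y)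
      where
      regroup : ∀ k p y d → k + p * y + y * d ≡ k + y * (p + d)
      regroup = solve-∀

  orbitSize-Rotated : ∀ {r x} → Rotated r x → orbitSize x ≡ orbitSize r
  orbitSize-Rotated {r} (t , refl) =
    trans (orbitSize≡period (rot^ t r) (LeastPeriod-rot^ r t (leastPeriod r))) (sym (orbitSize≡period r (leastPeriod r)))

  blues-Rotated : ∀ {r x} → Rotated r x → blues x ≡ blues r
  blues-Rotated {r} (t , refl) = blues-rot^ r t

  EvenOrbit-Rotated : ∀ {r x} → Rotated r x → EvenOrbit r → EvenOrbit x
  EvenOrbit-Rotated r~x = subst (2 ∣_) (sym (orbitSize-Rotated r~x))

module Palindromes (N′ : ℕ) where
  open Cyclic N′

  -- Fixed by σ_{N−1} : P_m ↦ P_{N−1−m}, i.e. c read backwards is c; for even N this axis is of type 1.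
  Palindrome : Coloring N → Set
  Palindrome c = refl-k N′ c ≡ c

  palindrome? : ∀ c → Dec (Palindrome c)
  palindrome? c = refl-k N′ c ≟c c

  odd-period⇒palindromic-rotation : ∀ k (r : Coloring N) (P : LeastPeriod r) q →
    LeastPeriod.period P ≡ suc (q + q) → Symmetric k r → Σ ℕ λ t → Palindrome (rot^ t r)
  odd-period⇒palindromic-rotation k r P q p≡2q+1 sym-r = t , Symmetric⇒refl-k N′ (rot^ t r)
    (Symmetric-∸period (k * p + N′) (rot^ t r) (Periodic-rot^ p t periodic) (period≤N P)
      (subst (λ z → Symmetric z (rot^ t r)) axis (Symmetric-rot^ k r t sym-r)))
    where
    open LeastPeriod P renaming (period to p)
    -- Since 2 (q + 1) ≡ 1 (mod p), this t solves k + 2 t ≡ N′ (mod p).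
    t : ℕ
    t = suc q * (N′ + (q + q) * k)
    axis : k + (t + t) ≡ N′ + p * (k * p + N′)
    axis = trans (identity k q N′) (cong (λ z → N′ + z * (k * z + N′)) (sym p≡2q+1))
      where
      identity : ∀ k q N′ → k + (suc q * (N′ + (q + q) * k) + suc q * (N′ + (q + q) * k))
                          ≡ N′ + suc (q + q) * (k * suc (q + q) + N′)
      identity = solve-∀

  palindromes-in-orbit : ∀ {c x : Coloring N} (P : LeastPeriod c) → Palindrome c → Palindrome x → Rotated c x →
    x ≡ c ⊎ Σ ℕ λ v → v + v ≡ LeastPeriod.period P × x ≡ rot^ v c
  palindromes-in-orbit {c} P pal-c pal-x (u , refl) =
    Sum.map (λ 2v≡0 → trans (rot^-%period P u) (cong (λ z → rot^ z c) (m+n≡0⇒m≡0 v 2v≡0)))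
            (λ 2v≡p → v , 2v≡p , rot^-%period P u)
            (∣∧<double⇒≡0⊎≡ p∣2v (+-mono-< v<p v<p))
    where
    open LeastPeriod P renaming (period to p)
    instance
      p-nonZero : NonZero p
      p-nonZero = >-nonZero period>0
    v : ℕ
    v = u % p
    v<p : v < p
    v<p = m%n<n u p
    p∣2v : p ∣ v + v
    p∣2v = Periodic⇒period∣ P (Symmetric-rot^⇒Periodic N′ c v (refl-k⇒Symmetric N′ c pal-c)
             (refl-k⇒Symmetric N′ (rot^ v c) (subst Palindrome (rot^-%period P u) pal-x)))

  palindrome⇒FFixed : ∀ {r x} → Palindrome x → Rotated r x → FFixed r
  palindrome⇒FFixed {r} pal (t , refl) = Symmetric-rot^⇒FFixed N′ r t (refl-k⇒Symmetric N′ (rot^ t r) pal)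

  odd-orbit⇒odd-period : ∀ (r : Coloring N) → ¬ EvenOrbit r →
                         Σ ℕ λ q → LeastPeriod.period (leastPeriod r) ≡ suc (q + q)
  odd-orbit⇒odd-period r odd with parity (LeastPeriod.period (leastPeriod r))
  ... | q , inj₁ p≡2q   = ⊥-elim (odd (double⇒2∣ q (trans (orbitSize≡period r (leastPeriod r)) p≡2q)))
  ... | q , inj₂ p≡2q+1 = q , p≡2q+1

  odd-orbit-palindrome : ∀ (r : Coloring N) → ¬ EvenOrbit r → FFixed r →
    Σ (Coloring N) λ c₀ → Rotated r c₀ × Palindrome c₀ × (∀ {x} → Palindrome x → Rotated r x → x ≡ c₀)
  odd-orbit-palindrome r odd f =
    let k , sym-r = FFixed⇒Symmetric r f
        q , p≡2q+1 = odd-orbit⇒odd-period r odd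
        t , pal₀ = odd-period⇒palindromic-rotation k r (leastPeriod r) q p≡2q+1 sym-r
        unique : ∀ {x} → Palindrome x → Rotated r x → x ≡ rot^ t r
        unique pal-x r~x = [ id , (λ (v , 2v≡p , _) → ⊥-elim (double≢odd v q (trans 2v≡p p≡2q+1))) ]′
          (palindromes-in-orbit (LeastPeriod-rot^ r t (leastPeriod r)) pal₀ pal-x
                                (Rotated-trans (Rotated-sym (t , refl)) r~x))
    in rot^ t r , (t , refl) , pal₀ , unique

  even-orbit-palindromes : ∀ {r c₀ : Coloring N} → EvenOrbit r → Rotated r c₀ → Palindrome c₀ →
    Σ (Coloring N) λ c₁ → c₀ ≢ c₁ × Rotated r c₁ × Palindrome c₁ ×
                          (∀ {x} → Palindrome x → Rotated r x → x ≡ c₀ ⊎ x ≡ c₁)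
  even-orbit-palindromes {r} {c₀} even r~c₀ pal₀ = rot^ q c₀ , c₀≢c₁ , Rotated-trans r~c₀ (q , refl) , pal₁ , only
    where
    P₀ : LeastPeriod c₀
    P₀ = leastPeriod c₀
    open LeastPeriod P₀
    half : Σ ℕ λ q → period ≡ q + q
    half = 2∣⇒double (subst (2 ∣_) (orbitSize≡period c₀ P₀) (EvenOrbit-Rotated r~c₀ even))
    q : ℕ
    q = proj₁ half
    p≡2q : period ≡ q + q
    p≡2q = proj₂ half
    q>0 : 0 < q
    q>0 = double>0⇒>0 (subst (0 <_) p≡2q period>0)
    c₀≢c₁ : c₀ ≢ rot^ q c₀
    c₀≢c₁ e = least q q>0 (subst (q <_) (sym p≡2q) (m<m+n q q>0)) (sym e)
    pal₁ : Palindrome (rot^ q c₀)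
    pal₁ = Symmetric⇒refl-k N′ (rot^ q c₀) (Periodic⇒Symmetric-rot^ N′ c₀ q (refl-k⇒Symmetric N′ c₀ pal₀)
             (subst (λ z → Periodic z c₀) p≡2q periodic))
    only : ∀ {x} → Palindrome x → Rotated r x → x ≡ c₀ ⊎ x ≡ rot^ q c₀
    only pal-x r~x =
      Sum.map₂ (λ (v , 2v≡p , e) → trans e (cong (λ z → rot^ z c₀) (double-injective v q (trans 2v≡p p≡2q))))
      (palindromes-in-orbit P₀ pal₀ pal-x (Rotated-trans (Rotated-sym r~c₀) r~x))

  mirrored⇒Palindrome : ∀ (c : Coloring N) → (∀ a b → a + b ≡ N′ → at c a ≡ at c b) → Palindrome c
  mirrored⇒Palindrome c mirrored = Symmetric⇒refl-k N′ c λ a b a+b≡N′ →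
    let r = a % N
        r≤N′ : r ≤ N′
        r≤N′ = s≤s⁻¹ (m%n<n a N)
        index : N′ ∸ r ≡ b [mod N ]
        index = mod-cancelʳ-+ a (mod-trans (mod-+ˡ (N′ ∸ r) (mod-sym (%-mod a)))
                  (mod-trans (mod-reflexive (m∸n+n≡m r≤N′))
                  (mod-trans (mod-sym a+b≡N′) (mod-reflexive (+-comm a b)))))
    in begin
    bead c a              ≡⟨ mirrored r (N′ ∸ r) (m+[n∸m]≡n r≤N′) ⟩
    at c (N′ ∸ r)         ≡⟨ bead-< c (s≤s (m∸n≤m N′ r)) ⟨
    bead c (N′ ∸ r)       ≡⟨ bead-cong c index ⟩
    bead c b              ∎
    where open ≡-Reasoning

  Palindrome⇒mirrored : ∀ {c : Coloring N} → Palindrome c → ∀ a b → a + b ≡ N′ → at c a ≡ at c b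
  Palindrome⇒mirrored {c} pal a b a+b≡N′ = begin
    at c a     ≡⟨ bead-< c (s≤s (≤-trans (m≤m+n a b) (≤-reflexive a+b≡N′))) ⟨
    bead c a   ≡⟨ refl-k⇒Symmetric N′ c pal a b (mod-reflexive a+b≡N′) ⟩
    bead c b   ≡⟨ bead-< c (s≤s (≤-trans (m≤n+m b a) (≤-reflexive a+b≡N′))) ⟩
    at c b     ∎
    where open ≡-Reasoning

module OrbitCounting (N′ : ℕ) where
  open Cyclic N′
  open Palindromes N′
  open Multiplicity (_≟c_ {N})

  InOrbit-sym : ∀ {x y : Coloring N} → InOrbit x y → InOrbit y x
  InOrbit-sym = Rotated⇒InOrbit ∘ Rotated-sym ∘ InOrbit⇒Rotated

  InOrbit-trans : ∀ {x y z : Coloring N} → InOrbit x y → InOrbit y z → InOrbit x z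
  InOrbit-trans x~y y~z = Rotated⇒InOrbit (Rotated-trans (InOrbit⇒Rotated x~y) (InOrbit⇒Rotated y~z))

  All-Orb : ∀ j → All (λ r → blues r ≡ j) (Orb N j)
  All-Orb j = All-deduplicate inOrbit? (All-Neck N j)

  Orb-meets-orbit-once : ∀ {j x} → blues x ≡ j → ∑[ r ∈ Orb N j ] 𝟙 (inOrbit? r x) ≡ 1
  Orb-meets-orbit-once {j} {x} refl = deduplicate-meets-class-once inOrbit? InOrbit-sym InOrbit-trans x (Neck N j)
    (Any.map (λ { refl → Rotated⇒InOrbit (0 , refl) })
             (∑𝟙≡suc⇒Any (_≟c x) (Neck N j) (multiplicity-Neck x refl)))

  ∑-over-orbits : ∀ {ℓ} {D : Coloring N → Set ℓ} (D? : ∀ x → Dec (D x)) j →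
    ∑[ x ∈ Neck N j ] 𝟙 (D? x) ≡ ∑[ r ∈ Orb N j ] ∑[ x ∈ Neck N j ] 𝟙 (D? x ×-dec inOrbit? r x)
  ∑-over-orbits D? j = trans (∑-congᴬ (All-Neck N j) split) (∑-comm (Neck N j) (Orb N j) _)
    where
    split : ∀ {x} → blues x ≡ j → 𝟙 (D? x) ≡ ∑[ r ∈ Orb N j ] 𝟙 (D? x ×-dec inOrbit? r x)
    split {x} bx = sym (begin
      ∑[ r ∈ Orb N j ] 𝟙 (D? x ×-dec inOrbit? r x)        ≡⟨ ∑-cong (Orb N j) (λ r → 𝟙-×-dec (D? x) (inOrbit? r x)) ⟩
      ∑[ r ∈ Orb N j ] (𝟙 (D? x) * 𝟙 (inOrbit? r x))      ≡⟨ ∑-*ˡ (Orb N j) (𝟙 (D? x)) _ ⟩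
      𝟙 (D? x) * ∑[ r ∈ Orb N j ] 𝟙 (inOrbit? r x)        ≡⟨ cong (𝟙 (D? x) *_) (Orb-meets-orbit-once bx) ⟩
      𝟙 (D? x) * 1                                        ≡⟨ *-identityʳ _ ⟩
      𝟙 (D? x)                                            ∎)
      where open ≡-Reasoning

  OddPalindrome : Coloring N → Set
  OddPalindrome x = Palindrome x × ¬ EvenOrbit x

  oddPalindrome? : ∀ x → Dec (OddPalindrome x)
  oddPalindrome? x = palindrome? x ×-dec ¬? (evenOrbit? x)

  odd-palindromes-in-orbit : ∀ {j} (r : Coloring N) → blues r ≡ j →
    ∑[ x ∈ Neck N j ] 𝟙 (oddPalindrome? x ×-dec inOrbit? r x) ≡ 𝟙 (¬? (evenOrbit? r) ×-dec fFixed? r)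
  odd-palindromes-in-orbit {j} r br = count (evenOrbit? r) (fFixed? r)
    where
    Q? : ∀ x → Dec (OddPalindrome x × InOrbit r x)
    Q? x = oddPalindrome? x ×-dec inOrbit? r x
    count : (e : Dec (EvenOrbit r)) (f : Dec (FFixed r)) → ∑[ x ∈ Neck N j ] 𝟙 (Q? x) ≡ 𝟙 (¬? e ×-dec f)
    count (yes even) _ = ∑𝟙-none Q? (Neck N j) λ x ((_ , odd) , r~x) →
      odd (EvenOrbit-Rotated (InOrbit⇒Rotated r~x) even)
    count (no _) (no ¬f) = ∑𝟙-none Q? (Neck N j) λ x ((pal , _) , r~x) →
      ¬f (palindrome⇒FFixed pal (InOrbit⇒Rotated r~x))
    count (no odd) (yes f) =
      let c₀ , r~c₀ , pal₀ , unique = odd-orbit-palindrome r odd f in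
      ∑𝟙-unique Q? (Neck N j) c₀ (λ x ((pal , _) , r~x) → unique pal (InOrbit⇒Rotated r~x))
        ((pal₀ , odd ∘ EvenOrbit-Rotated (Rotated-sym r~c₀)) , Rotated⇒InOrbit r~c₀)
        (multiplicity-Neck c₀ (trans (blues-Rotated r~c₀) br))

  count-odd-palindromes : ∀ j → ∑[ x ∈ Neck N j ] 𝟙 (oddPalindrome? x) ≡ countOddFixed N j
  count-odd-palindromes j = begin
    ∑[ x ∈ Neck N j ] 𝟙 (oddPalindrome? x)
      ≡⟨ ∑-over-orbits oddPalindrome? j ⟩
    ∑[ r ∈ Orb N j ] ∑[ x ∈ Neck N j ] 𝟙 (oddPalindrome? x ×-dec inOrbit? r x)
      ≡⟨ ∑-congᴬ (All-Orb j) (odd-palindromes-in-orbit _) ⟩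
    ∑[ r ∈ Orb N j ] 𝟙 (¬? (evenOrbit? r) ×-dec fFixed? r)
      ≡⟨ length-filter _ (Orb N j) ⟨
    countOddFixed N j
      ∎
    where open ≡-Reasoning

module EvenLength (h′ : ℕ) where
  N′ : ℕ
  N′ = h′ + suc h′

  open Cyclic N′
  open Palindromes N′
  open OrbitCounting N′
  open Multiplicity (_≟c_ {N})

  type1⇒palindromic-rotation : ∀ {r : Coloring N} → OrbitType1 r →
                               Σ (Coloring N) λ c₀ → Rotated r c₀ × Palindrome c₀
  type1⇒palindromic-rotation {r} type1 with Any.applyUpTo⁻ id (Any.map⁻ type1)
  ... | t , _ , axis with Any.applyUpTo⁻ id axis
  ...   | k , k<N , (k-odd , fixed) with parity k
  ...     | a , inj₁ refl = ⊥-elim (k-odd (double⇒2∣ a refl))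
  ...     | a , inj₂ refl = rot^ (h′ ∸ a) (rot^ t r) , (h′ ∸ a + t , sym (rot^-+ (h′ ∸ a) t r)) ,
            Symmetric⇒refl-k N′ _ (subst (λ z → Symmetric z (rot^ (h′ ∸ a) (rot^ t r))) centred
              (Symmetric-rot^ (suc (a + a)) (rot^ t r) (h′ ∸ a) (refl-k⇒Symmetric (suc (a + a)) (rot^ t r) fixed)))
    where
    a≤h′ : a ≤ h′
    a≤h′ = ≮⇒≥ λ h′<a →
      <⇒≱ (+-mono-< h′<a h′<a) (s≤s⁻¹ (≤-trans (s≤s⁻¹ k<N) (≤-reflexive (+-suc h′ h′))))
    regroup : ∀ a d → suc (a + a) + (d + d) ≡ (a + d) + suc (a + d)
    regroup = solve-∀
    centred : suc (a + a) + ((h′ ∸ a) + (h′ ∸ a)) ≡ N′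
    centred = trans (regroup a (h′ ∸ a)) (cong (λ z → z + suc z) (m+[n∸m]≡n a≤h′))

  palindrome⇒type1 : ∀ {r x : Coloring N} → Palindrome x → Rotated r x → OrbitType1 r
  palindrome⇒type1 {r} pal (t , refl) = Any.map⁺ (Any.applyUpTo⁺ id (subst HasType1Axis (rot^-% r t) axis) (m%n<n t N))
    where
    axis : HasType1Axis (rot^ t r)
    axis = Any.applyUpTo⁺ id (odd⇒2∤ h′ (+-suc h′ h′) , pal) ≤-refl

  EvenPalindrome : Coloring N → Set
  EvenPalindrome x = Palindrome x × EvenOrbit x

  evenPalindrome? : ∀ x → Dec (EvenPalindrome x)
  evenPalindrome? x = palindrome? x ×-dec evenOrbit? x

  even-palindromes-in-orbit : ∀ {j} (r : Coloring N) → blues r ≡ j →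
    ∑[ x ∈ Neck N j ] 𝟙 (evenPalindrome? x ×-dec inOrbit? r x)
      ≡ 2 * 𝟙 (evenOrbit? r ×-dec fFixed? r ×-dec orbitType1? r)
  even-palindromes-in-orbit {j} r br = count (evenOrbit? r) (fFixed? r) (orbitType1? r)
    where
    Q? : ∀ x → Dec (EvenPalindrome x × InOrbit r x)
    Q? x = evenPalindrome? x ×-dec inOrbit? r x
    count : (e : Dec (EvenOrbit r)) (f : Dec (FFixed r)) (t : Dec (OrbitType1 r)) →
            ∑[ x ∈ Neck N j ] 𝟙 (Q? x) ≡ 2 * 𝟙 (e ×-dec f ×-dec t)
    count (no odd) _ _ = ∑𝟙-none Q? (Neck N j) λ x ((_ , even) , r~x) →
      odd (EvenOrbit-Rotated (Rotated-sym (InOrbit⇒Rotated r~x)) even)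
    count e@(yes _) f (no ¬t) = trans
      (∑𝟙-none Q? (Neck N j) λ x ((pal , _) , r~x) → ¬t (palindrome⇒type1 pal (InOrbit⇒Rotated r~x)))
      (cong (2 *_) (sym (𝟙-no (¬t ∘ proj₂ ∘ proj₂) (e ×-dec f ×-dec no ¬t))))
    count (yes even) (no ¬f) (yes t) =
      let _ , r~c₀ , pal₀ = type1⇒palindromic-rotation t in ⊥-elim (¬f (palindrome⇒FFixed pal₀ r~c₀))
    count (yes even) (yes f) (yes t) =
      let c₀ , r~c₀ , pal₀ = type1⇒palindromic-rotation t
          c₁ , c₀≢c₁ , r~c₁ , pal₁ , only = even-orbit-palindromes even r~c₀ pal₀
      in ∑𝟙-pair Q? (Neck N j) c₀ c₁ c₀≢c₁ (λ x ((pal , _) , r~x) → only pal (InOrbit⇒Rotated r~x))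
           ((pal₀ , EvenOrbit-Rotated r~c₀ even) , Rotated⇒InOrbit r~c₀)
           ((pal₁ , EvenOrbit-Rotated r~c₁ even) , Rotated⇒InOrbit r~c₁)
           (multiplicity-Neck c₀ (trans (blues-Rotated r~c₀) br))
           (multiplicity-Neck c₁ (trans (blues-Rotated r~c₁) br))

  count-even-palindromes : ∀ j → ∑[ x ∈ Neck N j ] 𝟙 (evenPalindrome? x) ≡ 2 * countEvenFixedType1 N j
  count-even-palindromes j = begin
    ∑[ x ∈ Neck N j ] 𝟙 (evenPalindrome? x)
      ≡⟨ ∑-over-orbits evenPalindrome? j ⟩
    ∑[ r ∈ Orb N j ] ∑[ x ∈ Neck N j ] 𝟙 (evenPalindrome? x ×-dec inOrbit? r x)
      ≡⟨ ∑-congᴬ (All-Orb j) (even-palindromes-in-orbit _) ⟩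
    ∑[ r ∈ Orb N j ] (2 * 𝟙 (evenOrbit? r ×-dec fFixed? r ×-dec orbitType1? r))
      ≡⟨ ∑-*ˡ (Orb N j) 2 _ ⟩
    2 * ∑[ r ∈ Orb N j ] 𝟙 (evenOrbit? r ×-dec fFixed? r ×-dec orbitType1? r)
      ≡⟨ cong (2 *_) (length-filter _ (Orb N j)) ⟨
    2 * countEvenFixedType1 N j
      ∎
    where open ≡-Reasoning

module Halving (h′ : ℕ) where
  open EvenLength h′ using (N′)
  open EvenLength h′ using (evenPalindrome?; count-even-palindromes)

  h : ℕ
  h = suc h′

  private
    module Cₙ = Cyclic N′
    module Cₕ = Cyclic h′
    module Palₙ = Palindromes N′
    module Palₕ = Palindromes h′
    module Oₙ = OrbitCounting N′
    module Oₕ = OrbitCounting h′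

  mirror : Vec Bool h → Coloring (h + h)
  mirror y = y ++ reverse y

  blues-mirror : ∀ y → blues (mirror y) ≡ blues y + blues y
  blues-mirror y = trans (blues-++ y (reverse y)) (cong (blues y +_) (blues-reverse y))

  mirror-mirrored : ∀ y {a b} → a ≤ h′ → a + b ≡ N′ → at (mirror y) a ≡ at (mirror y) b
  mirror-mirrored y {a} {b} a≤h′ a+b≡N′ = begin
    at (y ++ reverse y) a         ≡⟨ at-++ˡ y (reverse y) (s≤s a≤h′) ⟩
    at y a                        ≡⟨ at-reverse y d a (cong suc (trans (+-comm d a) a+d≡h′)) ⟨
    at (reverse y) d              ≡⟨ at-++ʳ y (reverse y) d ⟨
    at (y ++ reverse y) (h + d)   ≡⟨ cong (at (y ++ reverse y)) b≡h+d ⟨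
    at (y ++ reverse y) b         ∎
    where
    open ≡-Reasoning
    d : ℕ
    d = h′ ∸ a
    a+d≡h′ : a + d ≡ h′
    a+d≡h′ = m+[n∸m]≡n a≤h′
    b≡h+d : b ≡ h + d
    b≡h+d = +-cancelˡ-≡ a b (h + d) (begin
      a + b             ≡⟨ a+b≡N′ ⟩
      h′ + h            ≡⟨ cong (_+ h) a+d≡h′ ⟨
      a + d + h         ≡⟨ +-assoc a d h ⟩
      a + (d + h)       ≡⟨ cong (a +_) (+-comm d h) ⟩
      a + (h + d)       ∎)

  mirror-Palindrome : ∀ y → Palₙ.Palindrome (mirror y)
  mirror-Palindrome y = Palₙ.mirrored⇒Palindrome (mirror y) mirrored
    where
    mirrored : ∀ a b → a + b ≡ N′ → at (mirror y) a ≡ at (mirror y) b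
    mirrored a b a+b≡N′ with a ≤? h′ | b ≤? h′
    ... | yes a≤h′ | _        = mirror-mirrored y a≤h′ a+b≡N′
    ... | no _     | yes b≤h′ = sym (mirror-mirrored y b≤h′ (trans (+-comm b a) a+b≡N′))
    ... | no a≰h′  | no b≰h′  =
      ⊥-elim (<-irrefl refl (≤-trans (+-mono-≤ (≰⇒> a≰h′) (≰⇒> b≰h′)) (≤-reflexive a+b≡N′)))

  Palindrome⇒mirror : ∀ {x} → Palₙ.Palindrome x → Σ (Vec Bool h) λ y → mirror y ≡ x
  Palindrome⇒mirror {x} pal = y , trans (cong (y ++_) (sym z≡reverse-y)) (sym x≡y++z)
    where
    y z : Vec Bool h
    y = proj₁ (splitAt h x)
    z = proj₁ (proj₂ (splitAt h x))
    x≡y++z : x ≡ y ++ z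
    x≡y++z = proj₂ (proj₂ (splitAt h x))
    z≡reverse-y : z ≡ reverse y
    z≡reverse-y = at-injective z (reverse y) entrywise
      where
      entrywise : ∀ c → c < h → at z c ≡ at (reverse y) c
      entrywise c c<h = begin
        at z c              ≡⟨ at-++ʳ y z c ⟨
        at (y ++ z) (h + c) ≡⟨ Palₙ.Palindrome⇒mirrored (subst Palₙ.Palindrome x≡y++z pal) (h + c) d
                                 (trans (+-assoc h c d) (trans (cong (h +_) c+d≡h′) (+-comm h h′))) ⟩
        at (y ++ z) d       ≡⟨ at-++ˡ y z (s≤s (≤-trans (m≤n+m d c) (≤-reflexive c+d≡h′))) ⟩
        at y d              ≡⟨ at-reverse y c d (cong suc c+d≡h′) ⟨
        at (reverse y) c    ∎
        where
        open ≡-Reasoning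
        d : ℕ
        d = h′ ∸ c
        c+d≡h′ : c + d ≡ h′
        c+d≡h′ = m+[n∸m]≡n (s≤s⁻¹ c<h)

  count-palindromes : ∀ k → ∑[ x ∈ Neck (h + h) (k + k) ] 𝟙 (Palₙ.palindrome? x) ≡ h C k
  count-palindromes k = trans
    (∑𝟙-injection _≟c_ _≟c_ Palₙ.palindrome? (λ y → blues y ≟ k) (Neck (h + h) (k + k)) (allColorings h) mirror
      (All-Neck (h + h) (k + k))
      (λ {y} by≡k → multiplicity-Neck (mirror y) (trans (blues-mirror y) (cong₂ _+_ by≡k by≡k)))
      (λ {y} _ → multiplicity-allColorings h y)
      (λ {y} _ → mirror-Palindrome y)
      onto
      (λ {y} {y′} → ++-injectiveˡ y y′))
    (count-blues h k)
    where
    onto : ∀ {x} → blues x ≡ k + k → Palₙ.Palindrome x → Σ (Vec Bool h) λ y → blues y ≡ k × mirror y ≡ x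
    onto bx pal = let y , my≡x = Palindrome⇒mirror pal in
      y , double-injective (blues y) _ (trans (sym (blues-mirror y)) (trans (cong blues my≡x) bx)) , my≡x

  odd-blues⇒¬Palindrome : ∀ a {x} → blues x ≡ suc (a + a) → ¬ Palₙ.Palindrome x
  odd-blues⇒¬Palindrome a bx pal = let y , my≡x = Palindrome⇒mirror pal in
    double≢odd (blues y) a (trans (sym (blues-mirror y)) (trans (cong blues my≡x) bx))

  bead-double : ∀ (y : Vec Bool h) a → Cₙ.bead (y ++ y) a ≡ Cₕ.bead y a
  bead-double y a = trans (at-double (a % (h + h)) (m%n<n a (h + h))) (Cₕ.bead-cong y (mod-halve (%-mod a)))
    where
    at-double : ∀ m → m < h + h → at (y ++ y) m ≡ Cₕ.bead y m
    at-double m m<2h with m <? h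
    ... | yes m<h = trans (at-++ˡ y y m<h) (sym (Cₕ.bead-< y m<h))
    ... | no m≮h = subst (λ m → at (y ++ y) m ≡ Cₕ.bead y m) (m+[n∸m]≡n h≤m) (second-half (m ∸ h) c<h)
      where
      h≤m : h ≤ m
      h≤m = ≮⇒≥ m≮h
      c<h : m ∸ h < h
      c<h = +-cancelˡ-< h (m ∸ h) h (subst (_< h + h) (sym (m+[n∸m]≡n h≤m)) m<2h)
      second-half : ∀ c → c < h → at (y ++ y) (h + c) ≡ Cₕ.bead y (h + c)
      second-half c c<h = trans (at-++ʳ y y c) (trans (sym (Cₕ.bead-< y c<h))
        (Cₕ.bead-cong y (mod-sym (mod-trans (mod-reflexive (+-comm h c)) (Cₕ.+N-mod c)))))

  Periodic-double : ∀ (y : Vec Bool h) s → Periodic s y → Periodic s (y ++ y)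
  Periodic-double y s ps = Cₙ.bead-shift⇒Periodic (y ++ y) λ a → begin
    Cₙ.bead (y ++ y) (a + s)   ≡⟨ bead-double y (a + s) ⟩
    Cₕ.bead y (a + s)          ≡⟨ Cₕ.Periodic⇒bead-shift y ps a ⟩
    Cₕ.bead y a                ≡⟨ bead-double y a ⟨
    Cₙ.bead (y ++ y) a         ∎
    where open ≡-Reasoning

  Periodic-undouble : ∀ (y : Vec Bool h) s → Periodic s (y ++ y) → Periodic s y
  Periodic-undouble y s ps = Cₕ.bead-shift⇒Periodic y λ a → begin
    Cₕ.bead y (a + s)          ≡⟨ bead-double y (a + s) ⟨
    Cₙ.bead (y ++ y) (a + s)   ≡⟨ Cₙ.Periodic⇒bead-shift (y ++ y) ps a ⟩
    Cₙ.bead (y ++ y) a         ≡⟨ bead-double y a ⟩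
    Cₕ.bead y a                ∎
    where open ≡-Reasoning

  orbitSize-double : ∀ (y : Vec Bool h) → orbitSize (y ++ y) ≡ orbitSize y
  orbitSize-double y = trans
    (Cₙ.orbitSize≡period (y ++ y) (LeastPeriod-transfer (Periodic-double y) (Periodic-undouble y) (Cₕ.leastPeriod y)))
    (sym (Cₕ.orbitSize≡period y (Cₕ.leastPeriod y)))

  Palindrome-double : ∀ {y : Vec Bool h} → Palₕ.Palindrome y → Palₙ.Palindrome (y ++ y)
  Palindrome-double {y} pal = Cₙ.Symmetric⇒refl-k N′ (y ++ y) λ a b a+b≡N′ → begin
    Cₙ.bead (y ++ y) a   ≡⟨ bead-double y a ⟩
    Cₕ.bead y a          ≡⟨ Cₕ.refl-k⇒Symmetric h′ y pal a b (mod-trans (mod-halve a+b≡N′) (Cₕ.+N-mod h′)) ⟩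
    Cₕ.bead y b          ≡⟨ bead-double y b ⟨
    Cₙ.bead (y ++ y) b   ∎
    where open ≡-Reasoning

  Palindrome-undouble : ∀ {y : Vec Bool h} → Palₙ.Palindrome (y ++ y) → Palₕ.Palindrome y
  Palindrome-undouble {y} pal = Cₕ.Symmetric⇒refl-k h′ y λ a b a+b≡h′ →
    let t , index = mod-double (mod-trans a+b≡h′ (mod-sym (Cₕ.+N-mod h′))) in begin
    Cₕ.bead y a                ≡⟨ Cₕ.bead-cong y (+*-mod a t) ⟨
    Cₕ.bead y (a + t * h)      ≡⟨ bead-double y (a + t * h) ⟨
    Cₙ.bead (y ++ y) (a + t * h) ≡⟨ Cₙ.refl-k⇒Symmetric N′ (y ++ y) pal (a + t * h) b
                                      (mod-trans (mod-reflexive (+-exchange a (t * h) b)) index) ⟩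
    Cₙ.bead (y ++ y) b         ≡⟨ bead-double y b ⟩
    Cₕ.bead y b                ∎
    where
    open ≡-Reasoning
    +-exchange : ∀ a c b → a + c + b ≡ a + b + c
    +-exchange a c b = trans (+-assoc a c b) (trans (cong (a +_) (+-comm c b)) (sym (+-assoc a b c)))

  Periodic-half⇒double : ∀ {x : Coloring (h + h)} → Periodic h x → Σ (Vec Bool h) λ y → y ++ y ≡ x
  Periodic-half⇒double {x} ph = y , trans (cong (y ++_) y≡z) (sym x≡y++z)
    where
    y z : Vec Bool h
    y = proj₁ (splitAt h x)
    z = proj₁ (proj₂ (splitAt h x))
    x≡y++z : x ≡ y ++ z
    x≡y++z = proj₂ (proj₂ (splitAt h x))
    y≡z : y ≡ z
    y≡z = at-injective y z λ c c<h → begin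
      at y c                        ≡⟨ at-++ˡ y z c<h ⟨
      at (y ++ z) c                 ≡⟨ Cₙ.bead-< (y ++ z) (≤-trans c<h (m≤m+n h h)) ⟨
      Cₙ.bead (y ++ z) c            ≡⟨ Cₙ.Periodic⇒bead-shift (y ++ z) (subst (Periodic h) x≡y++z ph) c ⟨
      Cₙ.bead (y ++ z) (c + h)      ≡⟨ cong (Cₙ.bead (y ++ z)) (+-comm c h) ⟩
      Cₙ.bead (y ++ z) (h + c)      ≡⟨ Cₙ.bead-< (y ++ z) (+-monoʳ-< h c<h) ⟩
      at (y ++ z) (h + c)           ≡⟨ at-++ʳ y z c ⟩
      at z c                        ∎
      where open ≡-Reasoning

  odd-orbit⇒Periodic-half : ∀ {x : Coloring (h + h)} → ¬ EvenOrbit x → Periodic h x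
  odd-orbit⇒Periodic-half {x} odd =
    Cₙ.period∣⇒Periodic lp (odd-∣-double⇒∣ {h = h} odd-period (Cₙ.Periodic⇒period∣ lp (Cₙ.Periodic-N x)))
    where
    lp : LeastPeriod x
    lp = Cₙ.leastPeriod x
    odd-period : ¬ 2 ∣ LeastPeriod.period lp
    odd-period = odd ∘ subst (2 ∣_) (sym (Cₙ.orbitSize≡period x lp))

  count-odd-palindromes-double : ∀ k → ∑[ x ∈ Neck (h + h) (k + k) ] 𝟙 (Oₙ.oddPalindrome? x) ≡ countOddFixed h k
  count-odd-palindromes-double k = begin
    ∑[ x ∈ Neck (h + h) (k + k) ] 𝟙 (Oₙ.oddPalindrome? x)
      ≡⟨ via-double ⟩
    ∑[ y ∈ allColorings h ] 𝟙 (blues y ≟ k ×-dec Oₕ.oddPalindrome? y)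
      ≡⟨ ∑-cong (allColorings h) (λ y → 𝟙-×-dec (blues y ≟ k) _) ⟩
    ∑[ y ∈ allColorings h ] (𝟙 (blues y ≟ k) * 𝟙 (Oₕ.oddPalindrome? y))
      ≡⟨ ∑-filter (λ y → blues y ≟ k) (allColorings h) _ ⟨
    ∑[ y ∈ Neck h k ] 𝟙 (Oₕ.oddPalindrome? y)
      ≡⟨ Oₕ.count-odd-palindromes k ⟩
    countOddFixed h k
      ∎
    where
    open ≡-Reasoning
    via-double : ∑[ x ∈ Neck (h + h) (k + k) ] 𝟙 (Oₙ.oddPalindrome? x)
               ≡ ∑[ y ∈ allColorings h ] 𝟙 (blues y ≟ k ×-dec Oₕ.oddPalindrome? y)
    via-double = ∑𝟙-injection _≟c_ _≟c_ Oₙ.oddPalindrome? (λ y → blues y ≟ k ×-dec Oₕ.oddPalindrome? y)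
      (Neck (h + h) (k + k)) (allColorings h) (λ y → y ++ y)
      (All-Neck (h + h) (k + k))
      (λ {y} (by≡k , _) → multiplicity-Neck (y ++ y) (trans (blues-++ y y) (cong₂ _+_ by≡k by≡k)))
      (λ {y} _ → multiplicity-allColorings h y)
      (λ {y} (_ , pal , odd) → Palindrome-double pal , odd ∘ subst (2 ∣_) (orbitSize-double y))
      onto
      (λ {y} {y′} → ++-injectiveˡ y y′)
      where
      onto : ∀ {x} → blues x ≡ k + k → Oₙ.OddPalindrome x →
             Σ (Vec Bool h) λ y → (blues y ≡ k × Oₕ.OddPalindrome y) × y ++ y ≡ x
      onto {x} bx (pal , odd) = let y , yy≡x = Periodic-half⇒double (odd-orbit⇒Periodic-half odd) in
        y , ( double-injective (blues y) k (trans (sym (blues-++ y y)) (trans (cong blues yy≡x) bx))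
            , Palindrome-undouble (subst Palₙ.Palindrome (sym yy≡x) pal)
            , odd ∘ subst (2 ∣_) (trans (sym (orbitSize-double y)) (cong orbitSize yy≡x)) ) , yy≡x

  even-blues : ∀ k → 2 * countEvenFixedType1 (h + h) (k + k) + countOddFixed h k ≡ h C k
  even-blues k = begin
    2 * countEvenFixedType1 (h + h) (k + k) + countOddFixed h k
      ≡⟨ cong₂ _+_ (count-even-palindromes (k + k)) (count-odd-palindromes-double k) ⟨
    ∑[ x ∈ Xs ] 𝟙 (evenPalindrome? x) + ∑[ x ∈ Xs ] 𝟙 (Oₙ.oddPalindrome? x)
      ≡⟨ ∑-+ Xs _ _ ⟨
    ∑[ x ∈ Xs ] (𝟙 (evenPalindrome? x) + 𝟙 (Oₙ.oddPalindrome? x))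
      ≡⟨ ∑-cong Xs (λ x → 𝟙-split (Palₙ.palindrome? x) (evenOrbit? x)) ⟨
    ∑[ x ∈ Xs ] 𝟙 (Palₙ.palindrome? x)
      ≡⟨ count-palindromes k ⟩
    h C k ∎
    where
    open ≡-Reasoning
    Xs : List (Coloring (h + h))
    Xs = Neck (h + h) (k + k)

  odd-blues : ∀ a → 2 * countEvenFixedType1 (h + h) (suc (a + a)) ≡ 0
  odd-blues a = trans (sym (count-even-palindromes (suc (a + a))))
    (∑-zeroᴬ (All-Neck (h + h) (suc (a + a))) (λ bx → 𝟙-no (odd-blues⇒¬Palindrome a bx ∘ proj₁) _))

double/2 : ∀ m → (m + m) / 2 ≡ m
double/2 m = trans (cong (_/ 2) (trans (cong (m +_) (sym (+-identityʳ m))) (*-comm 2 m))) (m*n/n≡m m 2)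

halfBinom-double : ∀ m k → halfBinom (m + m) (k + k) ≡ m C k
halfBinom-double m k rewrite dec-true (2 ∣? (k + k)) (double⇒2∣ k refl) | double/2 m | double/2 k = refl

halfOddFixed-double : ∀ m k → halfOddFixed (m + m) (k + k) ≡ countOddFixed m k
halfOddFixed-double m k rewrite dec-true (2 ∣? (k + k)) (double⇒2∣ k refl) | double/2 m | double/2 k = refl

halfBinom-odd : ∀ n a → halfBinom n (suc (a + a)) ≡ 0
halfBinom-odd n a rewrite dec-false (2 ∣? suc (a + a)) (odd⇒2∤ a refl) = refl

halfOddFixed-odd : ∀ n a → halfOddFixed n (suc (a + a)) ≡ 0
halfOddFixed-odd n a rewrite dec-false (2 ∣? suc (a + a)) (odd⇒2∤ a refl) = refl

proposition3p19-double : ∀ h′ j → let n = suc h′ + suc h′ in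
  2 * countEvenFixedType1 n j + halfOddFixed n j ≡ halfBinom n j
proposition3p19-double h′ j with parity j
... | k , inj₁ refl rewrite halfOddFixed-double (suc h′) k | halfBinom-double (suc h′) k = Halving.even-blues h′ k
... | a , inj₂ refl rewrite halfOddFixed-odd (suc h′ + suc h′) a | halfBinom-odd (suc h′ + suc h′) a =
  trans (+-identityʳ _) (Halving.odd-blues h′ a)

proposition3p19 : (n j : ℕ) → 2 ≤ n → 2 ∣ n → j ≤ n →
    2 * countEvenFixedType1 n j + halfOddFixed n j ≡ halfBinom n j
proposition3p19 n j 2≤n (divides zero refl) _ = contradiction 2≤n λ ()
proposition3p19 n j _ (divides (suc h′) refl) _ =
  subst (λ n → 2 * countEvenFixedType1 n j + halfOddFixed n j ≡ halfBinom n j)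
        double≡*2 (proposition3p19-double h′ j)
  where
  double≡*2 : suc h′ + suc h′ ≡ suc h′ * 2
  double≡*2 = trans (cong (suc h′ +_) (sym (+-identityʳ (suc h′)))) (*-comm 2 (suc h′))
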